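{- Let $q$ be a prime power, $n\ge 1$, and let $\mathcal{X}_{n,q}$ be one of $\mathrm{Alt}_{n,q}$, $\mathrm{Sym}_{n,q}$, $\mathrm{Her}_{n,q}$, with $\ell=2$ if $\mathcal{X}_{n,q}=\mathrm{Her}_{n,q}$ and $\ell=1$ otherwise, and $E=\mathbb{F}_{q^\ell}^n$. Let $V$ be a $v$-dimensional $\mathbb{F}_{q^\ell}$-subspace of $E$. Then the rank function $\rho$ of the $q$-polymatroid $\mathcal{M}[\mathcal{X}_{n,q}(V)]$ is given, for every $\mathbb{F}_{q^\ell}$-subspace $U\le E$, by \[ \rho(U)=\begin{cases} \binom{v}{2}-\binom{\dim_{\mathbb{F}_q}(V\cap U^\perp)}{2} & \text{if } \mathcal{X}_{n,q}=\mathrm{Alt}_{n,q},\\[2pt] \binom{v+1}{2}-\binom{\dim_{\mathbb{F}_q}(V\cap U^\perp)+1}{2} & \text{if } \mathcal{X}_{n,q}=\mathrm{Sym}_{n,q},\\[2pt] \bigl(v-\dim_{\mathbb{F}_{q^2}}(V\cap U^\perp)\bigr)\bigl(v+\dim_{\mathbb{F}_{q^2}}(V\cap U^\perp)\bigr) & \text{if } \mathcal{X}_{n,q}=\mathrm{Her}_{n,q}. \end{cases} \]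
   Context: $\mathrm{Alt}_{n,q}$ (resp. $\mathrm{Sym}_{n,q}$) is the $\mathbb{F}_q$-space of alternating (resp. symmetric) $n\times n$ matrices over $\mathbb{F}_q$; $\mathrm{Her}_{n,q}$ is the $\mathbb{F}_q$-space of Hermitian $n\times n$ matrices over $\mathbb{F}_{q^2}$ (i.e. $A^t=A^{\sigma}$, $\sigma$ the entrywise map $x\mapsto x^q$). For a matrix $A$ over $\mathbb{F}_{q^\ell}$, $\mathrm{colsp}(A)$ is the $\mathbb{F}_{q^\ell}$-span of its columns in $E$. For an $\mathbb{F}_{q^\ell}$-subspace $W\le E$, $\mathcal{X}_{n,q}(W)=\{A\in\mathcal{X}_{n,q}:\mathrm{colsp}(A)\le W\}$, an $\mathbb{F}_q$-linear code. For an $\mathbb{F}_q$-linear code $\mathcal{C}\subseteq\mathcal{X}_{n,q}$ and $W\le E$, $\mathcal{C}(W,c)=\{A\in\mathcal{C}:\mathrm{colsp}(A)\le W\}$. The $q$-polymatroid $\mathcal{M}[\mathcal{C}]$ is the pair $(\mathscr{L}(E),\rho)$, where $\mathscr{L}(E)$ is the lattice of $\mathbb{F}_{q^\ell}$-subspaces of $E$ and $\rho(U)=\dim_{\mathbb{F}_q}\mathcal{C}-\dim_{\mathbb{F}_q}\mathcal{C}(U^\perp,c)$, with $U^\perp$ the orthogonal complement of $U$ with respect to the standard bilinear form $\sum_i x_iy_i$ on $E$. -}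

module Defs where

open import Data.Nat as ℕ using (ℕ; zero; suc; _∸_)
open import Data.Nat.Combinatorics using (_C_)
open import Data.Nat.Primality using (Prime)
open import Data.Fin using (Fin)
open import Data.List using (List; length)
open import Data.List.Membership.Propositional using (_∈_)
open import Data.List.Relation.Unary.Unique.Propositional using (Unique)
open import Data.Product using (Σ; _×_; _,_)
open import Relation.Binary.PropositionalEquality using (_≡_)
open import Algebra.Structures using (IsCommutativeRing)
open import Relation.Nullary using (¬_)
open import Data.Unit using (⊤)

IsPrimePower : ℕ → Set
IsPrimePower q = Σ ℕ λ p → Σ ℕ λ k → Prime p × (1 ℕ.≤ k) × (q ≡ p ℕ.^ k)

record FiniteField : Set₁ where
  field
    K      : Set
    _+_    : K → K → K
    _*_    : K → K → K
    -_     : K → K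
    0#     : K
    1#     : K
    isCommutativeRing : IsCommutativeRing _≡_ _+_ _*_ -_ 0# 1#
    1≢0    : ¬ (1# ≡ 0#)
    inverse : ∀ x → ¬ (x ≡ 0#) → Σ K λ y → x * y ≡ 1#
    elems  : List K
    complete : ∀ x → x ∈ elems
    unique : Unique elems

  order : ℕ
  order = length elems

data Kind : Set where
  alt sym her : Kind

ℓ : Kind → ℕ
ℓ her = 2
ℓ _   = 1

-- The claimed value of ρ(U) given v = dim V and d = dim (V ∩ U^⊥).
formula : Kind → ℕ → ℕ → ℕ
formula alt v d = (v C 2) ∸ (d C 2)
formula sym v d = (suc v C 2) ∸ (suc d C 2)
formula her v d = (v ∸ d) ℕ.* (v ℕ.+ d)

-- Everything below lives over a finite field F = F_{q^ℓ}, with q given.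
module Over (F : FiniteField) (q : ℕ) where
  open FiniteField F

  infixl 8 _^_
  _^_ : K → ℕ → K
  x ^ zero  = 1#
  x ^ suc m = x * (x ^ m)

  σ : K → K
  σ x = x ^ q

  AllScalars : K → Set
  AllScalars _ = ⊤

  SubfieldFq : K → Set
  SubfieldFq x = x ^ q ≡ x

  sumFin : ∀ {m} → (Fin m → K) → K
  sumFin {zero}  f = 0#
  sumFin {suc m} f = f Fin.zero + sumFin (λ j → f (Fin.suc j))

  lin : ∀ {I : Set} {d} → (Fin d → K) → (Fin d → I → K) → I → K
  lin c b i = sumFin (λ j → c j * b j i)

  HasDim : {I : Set} → ((I → K) → Set) → (K → Set) → ℕ → Set
  HasDim {I} S Sc d =
    Σ (Fin d → I → K) λ b →
      (∀ j → S (b j))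
    × (∀ (c : Fin d → K) → (∀ j → Sc (c j)) → (∀ i → lin c b i ≡ 0#) → ∀ j → c j ≡ 0#)
    × (∀ x → S x → Σ (Fin d → K) λ c → (∀ j → Sc (c j)) × (∀ i → x i ≡ lin c b i))

  module Dim (n : ℕ) where
    E : Set
    E = Fin n → K

    Mat : Set
    Mat = Fin n × Fin n → K

    record IsSubspace (W : E → Set) : Set where
      field
        resp  : ∀ x y → (∀ i → x i ≡ y i) → W x → W y
        zero∈ : W (λ _ → 0#)
        +∈    : ∀ x y → W x → W y → W (λ i → x i + y i)
        *∈    : ∀ c x → W x → W (λ i → c * x i)

    _∩_ : (E → Set) → (E → Set) → E → Set
    (W ∩ W') x = W x × W' x

    dot : E → E → K
    dot x y = sumFin (λ i → x i * y i)

    _⊥ : (E → Set) → E → Set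
    (U ⊥) x = ∀ u → U u → dot x u ≡ 0#

    col : Mat → Fin n → E
    col A j i = A (i , j)

    colsp≤ : Mat → (E → Set) → Set
    colsp≤ A W = ∀ j → W (col A j)

    X : Kind → Mat → Set
    X alt A = (∀ i → A (i , i) ≡ 0#) × (∀ i j → A (j , i) ≡ - A (i , j))
    X sym A = ∀ i j → A (j , i) ≡ A (i , j)
    X her A = ∀ i j → A (j , i) ≡ σ (A (i , j))

    X[_] : Kind → (E → Set) → Mat → Set
    X[ k ] W A = X k A × colsp≤ A W

    _[_,c] : (Mat → Set) → (E → Set) → Mat → Set
    (C [ W ,c]) A = C A × colsp≤ A W

-- Fix a basis b of V and a dual family e, i.e. ⟨b i, e j⟩ = δ i j.
-- The congruence Z ↦ bᵀ Z σ(b) is an F_q-linear bijection from the v × v matrices of the given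
-- kind onto the n × n ones whose columns lie in V, with inverse A ↦ eᵀ A σ(e); since
-- C(U^⊥, c) = X_{n,q}(V ∩ U^⊥), both dimensions in ρ(U) are dimensions of spaces X_{w,q}.
-- A w+1 × w+1 matrix of the kind is determined by its corner, its first row and its lower-right
-- block, so dim X_{w+1} = c + w r + dim X_w, where r = [F_{q^ℓ} : F_q] and c is the F_q-dimension
-- of the admissible diagonal entries; this yields (w choose 2), (w+1 choose 2) and w².
-- For ℓ = 2 the Frobenius x ↦ x ^ q is an involutive automorphism (Fermat, binomial theorem), whose
-- fixed field F_q has the basis {1, ω} for any ω it moves; such ω exists since x ^ q − x has at most
-- q < q² roots. Dimensions are well defined since more than m vectors in F_q^m are dependent.

module Submission where

open import Defs hiding (sym)
open import Data.Nat as ℕ using (ℕ; zero; suc; _!)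
import Data.Nat.Properties as ℕ
import Data.Fin.Properties as Fin
open import Data.Nat.Divisibility using (_∣_; divides; ∣⇒≤; m∣m*n)
open import Data.Nat.DivMod using (m*[n/m]≡n)
open import Data.Nat.Primality using (Prime; euclidsLemma; prime⇒nonTrivial; prime⇒nonZero)
open import Data.Nat.Combinatorics using (_C_; nCn≡1; nC1≡n; k![n∸k]!∣n!; nCk+nC[k+1]≡[n+1]C[k+1])
open import Data.Nat.Combinatorics.Specification using (nCk≡n!/k![n-k]!)
open import Data.Fin as Fin using (Fin; zero; suc; _↑ˡ_; _↑ʳ_)
open import Data.Product using (Σ; _×_; _,_; proj₁; proj₂)
open import Data.Sum using (_⊎_; inj₁; inj₂)
open import Data.Empty using (⊥-elim)
open import Data.Unit using (⊤; tt)
open import Data.List as List using (List; []; _∷_; length)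
open import Data.List.Membership.Propositional using (_∈_; _∉_)
open import Data.List.Membership.Propositional.Properties.WithK using (unique⇒irrelevant)
open import Data.List.Relation.Unary.Any as Any using (here; there)
open import Data.List.Relation.Unary.Any.Properties using (lookup-index)
open import Data.List.Relation.Unary.All as All using (All; []; _∷_)
open import Data.List.Relation.Unary.AllPairs using ([]; _∷_)
open import Data.List.Relation.Unary.Unique.Propositional using (Unique)
import Data.List.Relation.Unary.Unique.Propositional.Properties as Unique
open import Data.List.Membership.Propositional.Properties using (∈-map⁺)
open import Data.List.Membership.Propositional.Properties.WithK using (unique∧set⇒bag)
open import Data.List.Relation.Binary.BagAndSetEquality using (∼bag⇒↭)
open import Data.List.Relation.Binary.Permutation.Propositional using (_↭_; ↭⇒↭ₛ)
import Data.List.Relation.Binary.Permutation.Propositional.Properties as ↭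
import Data.List.Relation.Binary.Permutation.Setoid.Properties as ↭ₛ
open import Function.Bundles using (mk⇔)
open import Relation.Nullary using (¬_; Dec; yes; no; ¬?)
open import Relation.Nullary.Decidable using (decidable-stable)
open import Relation.Binary.PropositionalEquality hiding (resp)
open import Algebra.Bundles using (CommutativeRing)
import Algebra.Solver.Ring.AlmostCommutativeRing as ACR
open import Data.Integer as ℤ using (ℤ)
import Data.Integer.Properties as ℤ
open import Data.Maybe using (Maybe; just; nothing)
open import Data.Vec.Functional using (insertAt; _++_)
open import Data.Vec.Functional.Properties using (insertAt-lookup; insertAt-punchIn; lookup-++ˡ; lookup-++ʳ; ++-cong)

prime∤m! : ∀ {p} → Prime p → ∀ m → m ℕ.< p → ¬ p ∣ m !
prime∤m! {p} p-prime zero m<p p∣1 = ℕ.<⇒≱ (ℕ.nonTrivial⇒n>1 p {{prime⇒nonTrivial p-prime}}) (∣⇒≤ p∣1)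
prime∤m! {p} p-prime (suc m) m<p p∣m! with euclidsLemma (suc m) (m !) p-prime p∣m!
... | inj₁ p∣1+m = ℕ.<⇒≱ m<p (∣⇒≤ p∣1+m)
... | inj₂ p∣m!′ = prime∤m! p-prime m (ℕ.<-trans (ℕ.n<1+n m) m<p) p∣m!′

n∣k![n∸k]!*nCk : ∀ {n k} → .{{ℕ.NonZero n}} → k ℕ.≤ n → n ∣ (k ! ℕ.* (n ℕ.∸ k) !) ℕ.* (n C k)
n∣k![n∸k]!*nCk {suc n} {k} k≤n = subst (suc n ∣_) (sym k![n∸k]!*nCk≡n!) (m∣m*n (n !))
  where
  instance _ = k ℕ.!* (suc n ℕ.∸ k) !≢0
  k![n∸k]!*nCk≡n! : (k ! ℕ.* (suc n ℕ.∸ k) !) ℕ.* (suc n C k) ≡ suc n !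
  k![n∸k]!*nCk≡n! = trans (cong (k ! ℕ.* (suc n ℕ.∸ k) ! ℕ.*_) (nCk≡n!/k![n-k]! k≤n)) (m*[n/m]≡n (k![n∸k]!∣n! k≤n))

-- p divides p! = k! (p ∸ k)! (p C k) but neither factorial.
prime∣pCk : ∀ {p} → Prime p → ∀ {k} → 0 ℕ.< k → k ℕ.< p → p ∣ p C k
prime∣pCk {p} p-prime {k} 0<k k<p with euclidsLemma _ _ p-prime (n∣k![n∸k]!*nCk {{prime⇒nonZero p-prime}} (ℕ.<⇒≤ k<p))
... | inj₂ p∣pCk = p∣pCk
... | inj₁ p∣k![p∸k]! with euclidsLemma (k !) _ p-prime p∣k![p∸k]!
...   | inj₁ p∣k! = ⊥-elim (prime∤m! p-prime k k<p p∣k!)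
...   | inj₂ p∣[p∸k]! = ⊥-elim (prime∤m! p-prime (p ℕ.∸ k) (ℕ.∸-monoʳ-< 0<k (ℕ.<⇒≤ k<p)) p∣[p∸k]!)

∀-↑ : ∀ m n {P : Fin (m ℕ.+ n) → Set} → (∀ i → P (i ↑ˡ n)) → (∀ j → P (m ↑ʳ j)) → ∀ t → P t
∀-↑ m n {P} P-left P-right t with Fin.splitAt m t in split≡
... | inj₁ i = subst P (Fin.splitAt⁻¹-↑ˡ split≡) (P-left i)
... | inj₂ j = subst P (Fin.splitAt⁻¹-↑ʳ split≡) (P-right j)

++-∀ : ∀ {A : Set} {P : A → Set} {m n} (f : Fin m → A) (g : Fin n → A) → (∀ i → P (f i)) → (∀ j → P (g j)) → ∀ t → P ((f ++ g) t)
++-∀ {m = m} f g Pf Pg t with Fin.splitAt m t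
... | inj₁ i = Pf i
... | inj₂ j = Pg j

suc[2w+w*w]≡[1+w]*[1+w] : ∀ w → suc (w ℕ.* 2 ℕ.+ w ℕ.* w) ≡ suc w ℕ.* suc w
suc[2w+w*w]≡[1+w]*[1+w] = solve 1 (λ w → con 1 :+ (w :* con 2 :+ w :* w) := (con 1 :+ w) :* (con 1 :+ w)) refl
  where open import Data.Nat.Solver using (module +-*-Solver)
        open +-*-Solver

v*v∸d*d≡[v∸d]*[v+d] : ∀ v d → v ℕ.* v ℕ.∸ d ℕ.* d ≡ (v ℕ.∸ d) ℕ.* (v ℕ.+ d)
v*v∸d*d≡[v∸d]*[v+d] v d = sym (begin
  (v ℕ.∸ d) ℕ.* (v ℕ.+ d)                        ≡⟨ ℕ.*-distribʳ-∸ (v ℕ.+ d) v d ⟩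
  v ℕ.* (v ℕ.+ d) ℕ.∸ d ℕ.* (v ℕ.+ d)            ≡⟨ cong₂ ℕ._∸_ (trans (ℕ.*-distribˡ-+ v v d) (ℕ.+-comm (v ℕ.* v) (v ℕ.* d)))
                                                                 (trans (ℕ.*-distribˡ-+ d v d) (cong (ℕ._+ d ℕ.* d) (ℕ.*-comm d v))) ⟩
  (v ℕ.* d ℕ.+ v ℕ.* v) ℕ.∸ (v ℕ.* d ℕ.+ d ℕ.* d) ≡⟨ ℕ.[m+n]∸[m+o]≡n∸o (v ℕ.* d) (v ℕ.* v) (d ℕ.* d) ⟩
  v ℕ.* v ℕ.∸ d ℕ.* d                            ∎)
  where open ≡-Reasoning

module FieldProperties (F : FiniteField) where
  open FiniteField F public using (K; 1≢0; inverse; elems; complete; unique; order)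

  ring : CommutativeRing _ _
  ring = record { isCommutativeRing = FiniteField.isCommutativeRing F }

  open CommutativeRing ring public
    using ( _+_; _*_; -_; _-_; 0#; 1#; +-comm; +-assoc; *-comm; *-assoc
          ; +-identityˡ; +-identityʳ; *-identityˡ; *-identityʳ; distribˡ; distribʳ
          ; zeroˡ; zeroʳ; -‿inverseʳ; -‿inverseˡ; semiring; commutativeSemiring; +-rawMonoid)
  open import Algebra.Properties.Ring (CommutativeRing.ring ring) public
    using (-‿involutive; -0#≈0#; -‿distribˡ-*; -‿distribʳ-*; -‿+-comm)
  open ≡-Reasoning

  -- Equality is decidable because every element has an index in the duplicate-free enumeration.
  infix 4 _≟_
  _≟_ : (x y : K) → Dec (x ≡ y)
  x ≟ y with Fin._≟_ (Any.index (complete x)) (Any.index (complete y))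
  ... | yes i≡j = yes (trans (lookup-index (complete x))
                        (trans (cong (List.lookup elems) i≡j) (sym (lookup-index (complete y)))))
  ... | no i≢j = no λ { refl → i≢j (cong Any.index (unique⇒irrelevant unique (complete x) (complete y))) }

  open import Algebra.Definitions.RawMonoid +-rawMonoid public using () renaming (_×_ to _·_)
  open import Algebra.Properties.Semiring.Mult semiring using (×-homo-+; ×1-homo-*)

  -- The ring solver needs a decidable coefficient ring mapping into K; we use ℤ.
  fromℤ : ℤ → K
  fromℤ (ℤ.+ n) = n · 1#
  fromℤ ℤ.-[1+ n ] = - (suc n · 1#)

  fromℤ-neg : ∀ i → fromℤ (ℤ.- i) ≡ - fromℤ i
  fromℤ-neg (ℤ.+ zero) = sym -0#≈0#
  fromℤ-neg (ℤ.+ suc n) = refl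
  fromℤ-neg ℤ.-[1+ n ] = sym (-‿involutive _)

  fromℤ-⊖ : ∀ m n → fromℤ (m ℤ.⊖ n) ≡ m · 1# - n · 1#
  fromℤ-⊖ m zero = begin
    m · 1#          ≡⟨ sym (+-identityʳ _) ⟩
    m · 1# + 0#     ≡⟨ cong (m · 1# +_) (sym -0#≈0#) ⟩
    m · 1# - 0#     ∎
  fromℤ-⊖ zero (suc n) = sym (+-identityˡ _)
  fromℤ-⊖ (suc m) (suc n) = begin
    fromℤ (suc m ℤ.⊖ suc n)        ≡⟨ cong fromℤ (ℤ.[1+m]⊖[1+n]≡m⊖n m n) ⟩
    fromℤ (m ℤ.⊖ n)                ≡⟨ fromℤ-⊖ m n ⟩
    a - b                          ≡⟨ cong (_- b) (sym (+-identityˡ a)) ⟩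
    (0# + a) - b                   ≡⟨ cong (λ z → (z + a) - b) (sym (-‿inverseʳ 1#)) ⟩
    ((1# - 1#) + a) - b            ≡⟨ cong (_- b) (+-assoc 1# (- 1#) a) ⟩
    (1# + (- 1# + a)) - b          ≡⟨ cong (λ z → (1# + z) - b) (+-comm (- 1#) a) ⟩
    (1# + (a - 1#)) - b            ≡⟨ cong (_- b) (sym (+-assoc 1# a (- 1#))) ⟩
    ((1# + a) - 1#) - b            ≡⟨ +-assoc (1# + a) (- 1#) (- b) ⟩
    (1# + a) + (- 1# + - b)        ≡⟨ cong ((1# + a) +_) (-‿+-comm 1# b) ⟩
    (1# + a) - (1# + b)            ∎
    where
    a = m · 1#
    b = n · 1#

  fromℤ-+ : ∀ i j → fromℤ (i ℤ.+ j) ≡ fromℤ i + fromℤ j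
  fromℤ-+ (ℤ.+ m) (ℤ.+ n) = ×-homo-+ 1# m n
  fromℤ-+ (ℤ.+ m) ℤ.-[1+ n ] = fromℤ-⊖ m (suc n)
  fromℤ-+ ℤ.-[1+ m ] (ℤ.+ n) = trans (fromℤ-⊖ n (suc m)) (+-comm _ _)
  fromℤ-+ ℤ.-[1+ m ] ℤ.-[1+ n ] = begin
    - (suc (suc (m ℕ.+ n)) · 1#)        ≡⟨ cong (λ k → - (suc k · 1#)) (sym (ℕ.+-suc m n)) ⟩
    - ((suc m ℕ.+ suc n) · 1#)          ≡⟨ cong -_ (×-homo-+ 1# (suc m) (suc n)) ⟩
    - (suc m · 1# + suc n · 1#)         ≡⟨ sym (-‿+-comm _ _) ⟩
    - (suc m · 1#) + - (suc n · 1#)     ∎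

  fromℤ-*-+ : ∀ m j → fromℤ (ℤ.+ m ℤ.* j) ≡ m · 1# * fromℤ j
  fromℤ-*-+ m (ℤ.+ n) = trans (cong fromℤ (sym (ℤ.pos-* m n))) (×1-homo-* m n)
  fromℤ-*-+ m ℤ.-[1+ n ] = begin
    fromℤ (ℤ.+ m ℤ.* ℤ.- ℤ.+ suc n)     ≡⟨ cong fromℤ (sym (ℤ.neg-distribʳ-* (ℤ.+ m) (ℤ.+ suc n))) ⟩
    fromℤ (ℤ.- (ℤ.+ m ℤ.* ℤ.+ suc n))   ≡⟨ fromℤ-neg (ℤ.+ m ℤ.* ℤ.+ suc n) ⟩
    - fromℤ (ℤ.+ m ℤ.* ℤ.+ suc n)       ≡⟨ cong -_ (fromℤ-*-+ m (ℤ.+ suc n)) ⟩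
    - (m · 1# * suc n · 1#)             ≡⟨ -‿distribʳ-* _ _ ⟩
    m · 1# * - (suc n · 1#)             ∎

  fromℤ-* : ∀ i j → fromℤ (i ℤ.* j) ≡ fromℤ i * fromℤ j
  fromℤ-* (ℤ.+ m) j = fromℤ-*-+ m j
  fromℤ-* ℤ.-[1+ m ] j = begin
    fromℤ (ℤ.- ℤ.+ suc m ℤ.* j)         ≡⟨ cong fromℤ (sym (ℤ.neg-distribˡ-* (ℤ.+ suc m) j)) ⟩
    fromℤ (ℤ.- (ℤ.+ suc m ℤ.* j))       ≡⟨ fromℤ-neg (ℤ.+ suc m ℤ.* j) ⟩
    - fromℤ (ℤ.+ suc m ℤ.* j)           ≡⟨ cong -_ (fromℤ-*-+ (suc m) j) ⟩
    - (suc m · 1# * fromℤ j)            ≡⟨ -‿distribˡ-* _ _ ⟩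
    - (suc m · 1#) * fromℤ j            ∎

  fromℤ-morphism : CommutativeRing.rawRing ℤ.+-*-commutativeRing ACR.-Raw-AlmostCommutative⟶ ACR.fromCommutativeRing ring
  fromℤ-morphism = record
    { ⟦_⟧ = fromℤ ; +-homo = fromℤ-+ ; *-homo = fromℤ-* ; -‿homo = fromℤ-neg
    ; 0-homo = refl ; 1-homo = +-identityʳ 1# }

  fromℤ-≟ : ∀ i j → Maybe (fromℤ i ≡ fromℤ j)
  fromℤ-≟ i j with i ℤ.≟ j
  ... | yes refl = just refl
  ... | no _ = nothing

  open import Algebra.Solver.Ring (CommutativeRing.rawRing ℤ.+-*-commutativeRing) (ACR.fromCommutativeRing ring) fromℤ-morphism fromℤ-≟ public
    using (solve; _:=_; _:+_; _:*_; :-_; _:-_; con)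

  _⁻¹⟨_⟩ : (x : K) → ¬ x ≡ 0# → K
  x ⁻¹⟨ x≢0 ⟩ = proj₁ (inverse x x≢0)

  *-inverseʳ : ∀ x (x≢0 : ¬ x ≡ 0#) → x * x ⁻¹⟨ x≢0 ⟩ ≡ 1#
  *-inverseʳ x x≢0 = proj₂ (inverse x x≢0)

  *-inverseˡ : ∀ x (x≢0 : ¬ x ≡ 0#) → x ⁻¹⟨ x≢0 ⟩ * x ≡ 1#
  *-inverseˡ x x≢0 = trans (*-comm _ _) (*-inverseʳ x x≢0)

  *-cancelˡ : ∀ x {y z} → ¬ x ≡ 0# → x * y ≡ x * z → y ≡ z
  *-cancelˡ x {y} {z} x≢0 e = begin
    y                ≡⟨ sym (*-identityˡ y) ⟩
    1# * y           ≡⟨ cong (_* y) (sym (*-inverseˡ x x≢0)) ⟩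
    (x′ * x) * y     ≡⟨ *-assoc x′ x y ⟩
    x′ * (x * y)     ≡⟨ cong (x′ *_) e ⟩
    x′ * (x * z)     ≡⟨ sym (*-assoc x′ x z) ⟩
    (x′ * x) * z     ≡⟨ cong (_* z) (*-inverseˡ x x≢0) ⟩
    1# * z           ≡⟨ *-identityˡ z ⟩
    z                ∎
    where x′ = x ⁻¹⟨ x≢0 ⟩

  zero-product : ∀ x y → x * y ≡ 0# → x ≡ 0# ⊎ y ≡ 0#
  zero-product x y e with x ≟ 0#
  ... | yes x≡0 = inj₁ x≡0
  ... | no x≢0 = inj₂ (*-cancelˡ x x≢0 (trans e (sym (zeroʳ x))))

  *-nonzero : ∀ {x y} → ¬ x ≡ 0# → ¬ y ≡ 0# → ¬ x * y ≡ 0#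
  *-nonzero {x} {y} x≢0 y≢0 e with zero-product x y e
  ... | inj₁ x≡0 = x≢0 x≡0
  ... | inj₂ y≡0 = y≢0 y≡0

  x-y≡0⇒x≡y : ∀ {x y} → x - y ≡ 0# → x ≡ y
  x-y≡0⇒x≡y {x} {y} e = begin
    x             ≡⟨ solve 2 (λ x y → x := (x :- y) :+ y) refl x y ⟩
    (x - y) + y   ≡⟨ cong (_+ y) e ⟩
    0# + y        ≡⟨ +-identityˡ y ⟩
    y             ∎

module Sums (F : FiniteField) (q : ℕ) where
  open FieldProperties F
  open Over F q
  open ≡-Reasoning

  sumFin-cong : ∀ {m} {f g : Fin m → K} → (∀ i → f i ≡ g i) → sumFin f ≡ sumFin g
  sumFin-cong {zero} e = refl
  sumFin-cong {suc m} e = cong₂ _+_ (e zero) (sumFin-cong (λ i → e (suc i)))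

  sumFin-zero : ∀ {m} {f : Fin m → K} → (∀ i → f i ≡ 0#) → sumFin f ≡ 0#
  sumFin-zero {zero} e = refl
  sumFin-zero {suc m} e = trans (cong₂ _+_ (e zero) (sumFin-zero (λ i → e (suc i)))) (+-identityˡ 0#)

  sumFin-+ : ∀ {m} (f g : Fin m → K) → sumFin (λ i → f i + g i) ≡ sumFin f + sumFin g
  sumFin-+ {zero} f g = sym (+-identityˡ 0#)
  sumFin-+ {suc m} f g = trans (cong (f zero + g zero +_) (sumFin-+ (λ i → f (suc i)) (λ i → g (suc i))))
    (solve 4 (λ a b c d → (a :+ b) :+ (c :+ d) := (a :+ c) :+ (b :+ d)) refl _ _ _ _)

  *-distribˡ-sumFin : ∀ {m} c (f : Fin m → K) → c * sumFin f ≡ sumFin (λ i → c * f i)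
  *-distribˡ-sumFin {zero} c f = zeroʳ c
  *-distribˡ-sumFin {suc m} c f = trans (distribˡ c _ _) (cong (c * f zero +_) (*-distribˡ-sumFin c (λ i → f (suc i))))

  *-distribʳ-sumFin : ∀ {m} c (f : Fin m → K) → sumFin f * c ≡ sumFin (λ i → f i * c)
  *-distribʳ-sumFin c f = trans (*-comm _ c) (trans (*-distribˡ-sumFin c f) (sumFin-cong (λ i → *-comm c (f i))))

  -‿sumFin : ∀ {m} (f : Fin m → K) → - sumFin f ≡ sumFin (λ i → - f i)
  -‿sumFin {zero} f = -0#≈0#
  -‿sumFin {suc m} f = trans (sym (-‿+-comm _ _)) (cong (- f zero +_) (-‿sumFin (λ i → f (suc i))))

  sumFin-swap : ∀ {m n} (f : Fin m → Fin n → K) →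
                sumFin (λ i → sumFin (λ j → f i j)) ≡ sumFin (λ j → sumFin (λ i → f i j))
  sumFin-swap {zero} {n} f = sym (sumFin-zero {n} (λ _ → refl))
  sumFin-swap {suc m} f = begin
    sumFin (f zero) + sumFin (λ i → sumFin (f (suc i)))          ≡⟨ cong (sumFin (f zero) +_) (sumFin-swap (λ i → f (suc i))) ⟩
    sumFin (f zero) + sumFin (λ j → sumFin (λ i → f (suc i) j))  ≡⟨ sym (sumFin-+ (f zero) _) ⟩
    sumFin (λ j → f zero j + sumFin (λ i → f (suc i) j))         ∎

  sumFin-↑ : ∀ m n (f : Fin (m ℕ.+ n) → K) → sumFin f ≡ sumFin (λ i → f (i ↑ˡ n)) + sumFin (λ j → f (m ↑ʳ j))
  sumFin-↑ zero n f = sym (+-identityˡ _)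
  sumFin-↑ (suc m) n f = trans (cong (f zero +_) (sumFin-↑ m n (λ i → f (suc i)))) (sym (+-assoc _ _ _))

  sumFin-++ : ∀ {A : Set} m n (f : Fin m → A) (g : Fin n → A) (h : Fin (m ℕ.+ n) → A → K) →
              sumFin (λ t → h t ((f ++ g) t)) ≡ sumFin (λ i → h (i ↑ˡ n) (f i)) + sumFin (λ j → h (m ↑ʳ j) (g j))
  sumFin-++ m n f g h = trans (sumFin-↑ m n _)
    (cong₂ _+_ (sumFin-cong (λ i → cong (h (i ↑ˡ n)) (lookup-++ˡ f g i))) (sumFin-cong (λ j → cong (h (m ↑ʳ j)) (lookup-++ʳ f g j))))

  sumFin-++-zeroʳ : ∀ {A : Set} m n (f : Fin m → A) (g : Fin n → A) (h : Fin (m ℕ.+ n) → A → K) → (∀ j → h (m ↑ʳ j) (g j) ≡ 0#) →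
                    sumFin (λ t → h t ((f ++ g) t)) ≡ sumFin (λ i → h (i ↑ˡ n) (f i))
  sumFin-++-zeroʳ m n f g h g≡0 = trans (sumFin-++ m n f g h) (trans (cong (_ +_) (sumFin-zero g≡0)) (+-identityʳ _))

  sumFin-++-zeroˡ : ∀ {A : Set} m n (f : Fin m → A) (g : Fin n → A) (h : Fin (m ℕ.+ n) → A → K) → (∀ i → h (i ↑ˡ n) (f i) ≡ 0#) →
                    sumFin (λ t → h t ((f ++ g) t)) ≡ sumFin (λ j → h (m ↑ʳ j) (g j))
  sumFin-++-zeroˡ m n f g h f≡0 = trans (sumFin-++ m n f g h) (trans (cong (_+ _) (sumFin-zero f≡0)) (+-identityˡ _))

  sumFin-combine : ∀ a b (f : Fin (a ℕ.* b) → K) → sumFin f ≡ sumFin (λ (i : Fin a) → sumFin (λ (j : Fin b) → f (Fin.combine i j)))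
  sumFin-combine zero b f = refl
  sumFin-combine (suc a) b f = trans (sumFin-↑ b (a ℕ.* b) f) (cong (sumFin (λ j → f (j ↑ˡ (a ℕ.* b))) +_) (sumFin-combine a b (λ t → f (b ↑ʳ t))))

  sumFin-last : ∀ m (f : Fin (suc m) → K) → sumFin f ≡ sumFin (λ i → f (Fin.inject₁ i)) + f (Fin.fromℕ m)
  sumFin-last zero f = trans (+-identityʳ _) (sym (+-identityˡ _))
  sumFin-last (suc m) f = trans (cong (f zero +_) (sumFin-last m (λ i → f (suc i)))) (sym (+-assoc _ _ _))

  sumFin-punchIn : ∀ {m} (i : Fin (suc m)) (f : Fin (suc m) → K) → sumFin f ≡ f i + sumFin (λ k → f (Fin.punchIn i k))
  sumFin-punchIn zero f = refl
  sumFin-punchIn {suc m} (suc i) f = begin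
    f zero + sumFin (λ k → f (suc k))                                   ≡⟨ cong (f zero +_) (sumFin-punchIn i (λ k → f (suc k))) ⟩
    f zero + (f (suc i) + sumFin (λ k → f (suc (Fin.punchIn i k))))    ≡⟨ solve 3 (λ a b c → a :+ (b :+ c) := b :+ (a :+ c)) refl _ _ _ ⟩
    f (suc i) + (f zero + sumFin (λ k → f (suc (Fin.punchIn i k))))    ∎

  δ : ∀ {m} → Fin m → Fin m → K
  δ zero zero = 1#
  δ zero (suc j) = 0#
  δ (suc i) zero = 0#
  δ (suc i) (suc j) = δ i j

  δ-sym : ∀ {m} (i j : Fin m) → δ i j ≡ δ j i
  δ-sym zero zero = refl
  δ-sym zero (suc j) = refl
  δ-sym (suc i) zero = refl
  δ-sym (suc i) (suc j) = δ-sym i j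

  sumFin-δ : ∀ {m} (i : Fin m) (f : Fin m → K) → sumFin (λ j → δ i j * f j) ≡ f i
  sumFin-δ {suc m} zero f = begin
    1# * f zero + sumFin (λ j → 0# * f (suc j))  ≡⟨ cong₂ _+_ (*-identityˡ _) (sumFin-zero (λ j → zeroˡ (f (suc j)))) ⟩
    f zero + 0#                                  ≡⟨ +-identityʳ _ ⟩
    f zero                                       ∎
  sumFin-δ {suc m} (suc i) f = trans (cong₂ _+_ (zeroˡ _) (sumFin-δ i (λ j → f (suc j)))) (+-identityˡ _)

  sumFin-δʳ : ∀ {m} (i : Fin m) (f : Fin m → K) → sumFin (λ j → f j * δ j i) ≡ f i
  sumFin-δʳ i f = trans (sumFin-cong (λ j → trans (*-comm _ _) (cong (_* f j) (δ-sym j i)))) (sumFin-δ i f)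

  alternating-sumFin : ∀ {m} (f : Fin m → Fin m → K) → (∀ i → f i i ≡ 0#) → (∀ i j → f j i ≡ - f i j) →
                       sumFin (λ i → sumFin (λ j → f i j)) ≡ 0#
  alternating-sumFin {zero} f diag anti = refl
  alternating-sumFin {suc m} f diag anti = begin
    (f zero zero + row) + sumFin (λ i → f (suc i) zero + sumFin (λ j → f (suc i) (suc j)))
      ≡⟨ cong₂ _+_ (cong (_+ row) (diag zero)) (sumFin-+ (λ i → f (suc i) zero) _) ⟩
    (0# + row) + (sumFin (λ i → f (suc i) zero) + sumFin (λ i → sumFin (λ j → f (suc i) (suc j))))
      ≡⟨ cong₂ (λ u v → (0# + row) + (u + v)) column (alternating-sumFin _ (λ i → diag (suc i)) (λ i j → anti (suc i) (suc j))) ⟩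
    (0# + row) + (- row + 0#)
      ≡⟨ solve 1 (λ s → (con ℤ.0ℤ :+ s) :+ (:- s :+ con ℤ.0ℤ) := con ℤ.0ℤ) refl row ⟩
    0# ∎
    where
    row = sumFin (λ j → f zero (suc j))
    column : sumFin (λ i → f (suc i) zero) ≡ - row
    column = trans (sumFin-cong (λ i → anti zero (suc i))) (sym (-‿sumFin {m} (λ j → f zero (suc j))))

module FiniteFieldFacts (F : FiniteField) (q : ℕ) where
  open FieldProperties F
  open Over F q
  open Sums F q
  open ≡-Reasoning

  ^-+ : ∀ x m n → x ^ (m ℕ.+ n) ≡ x ^ m * x ^ n
  ^-+ x zero n = sym (*-identityˡ _)
  ^-+ x (suc m) n = trans (cong (x *_) (^-+ x m n)) (sym (*-assoc _ _ _))

  ^-distrib-* : ∀ x y n → (x * y) ^ n ≡ x ^ n * y ^ n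
  ^-distrib-* x y zero = sym (*-identityˡ _)
  ^-distrib-* x y (suc n) = trans (cong ((x * y) *_) (^-distrib-* x y n))
    (solve 4 (λ a b c d → (a :* b) :* (c :* d) := (a :* c) :* (b :* d)) refl x y (x ^ n) (y ^ n))

  ^-* : ∀ x m n → x ^ (m ℕ.* n) ≡ (x ^ m) ^ n
  ^-* x m zero = cong (x ^_) (ℕ.*-zeroʳ m)
  ^-* x m (suc n) = begin
    x ^ (m ℕ.* suc n)        ≡⟨ cong (x ^_) (ℕ.*-suc m n) ⟩
    x ^ (m ℕ.+ m ℕ.* n)      ≡⟨ ^-+ x m (m ℕ.* n) ⟩
    x ^ m * x ^ (m ℕ.* n)    ≡⟨ cong (x ^ m *_) (^-* x m n) ⟩
    x ^ m * (x ^ m) ^ n      ∎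

  1^n≡1 : ∀ n → 1# ^ n ≡ 1#
  1^n≡1 zero = refl
  1^n≡1 (suc n) = trans (*-identityˡ _) (1^n≡1 n)

  x^n≡0⇒x≡0 : ∀ x n → x ^ n ≡ 0# → x ≡ 0#
  x^n≡0⇒x≡0 x zero e = ⊥-elim (1≢0 e)
  x^n≡0⇒x≡0 x (suc n) e with zero-product x (x ^ n) e
  ... | inj₁ x≡0 = x≡0
  ... | inj₂ xⁿ≡0 = x^n≡0⇒x≡0 x n xⁿ≡0

  ·1-^ : ∀ m n → (m ℕ.^ n) · 1# ≡ (m · 1#) ^ n
  ·1-^ m zero = +-identityʳ 1#
  ·1-^ m (suc n) = trans (×1-homo-* m (m ℕ.^ n)) (cong (m · 1# *_) (·1-^ m n))
    where open import Algebra.Properties.Semiring.Mult semiring using (×1-homo-*)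

  sumList productList : List K → K
  sumList = List.foldr _+_ 0#
  productList = List.foldr _*_ 1#

  sumList-↭ : ∀ {xs ys} → xs ↭ ys → sumList xs ≡ sumList ys
  sumList-↭ p = ↭ₛ.foldr-commMonoid (setoid K) (CommutativeRing.+-isCommutativeMonoid ring) (↭⇒↭ₛ p)

  productList-↭ : ∀ {xs ys} → xs ↭ ys → productList xs ≡ productList ys
  productList-↭ p = ↭ₛ.foldr-commMonoid (setoid K) (CommutativeRing.*-isCommutativeMonoid ring) (↭⇒↭ₛ p)

  map-elems-↭ : (g h : K → K) → (∀ x → g (h x) ≡ x) → (∀ x → h (g x) ≡ x) → List.map g elems ↭ elems
  map-elems-↭ g h gh hg = ∼bag⇒↭ (unique∧set⇒bag (Unique.map⁺ g-injective unique) unique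
    (λ {x} → mk⇔ (λ _ → complete x) (λ _ → subst (_∈ List.map g elems) (gh x) (∈-map⁺ g (complete (h x))))))
    where
    g-injective : ∀ {x y} → g x ≡ g y → x ≡ y
    g-injective {x} {y} e = trans (sym (hg x)) (trans (cong h e) (hg y))

  sumList-+1 : ∀ xs → sumList (List.map (_+ 1#) xs) ≡ sumList xs + length xs · 1#
  sumList-+1 [] = sym (+-identityˡ 0#)
  sumList-+1 (x ∷ xs) = trans (cong ((x + 1#) +_) (sumList-+1 xs))
    (solve 4 (λ a b c o → (a :+ o) :+ (b :+ c) := (a :+ b) :+ (o :+ c)) refl x (sumList xs) (length xs · 1#) 1#)

  -- Translation by 1 permutes the elements, so it does not change their sum.
  order·1≡0 : order · 1# ≡ 0#
  order·1≡0 = begin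
    order · 1#                             ≡⟨ solve 2 (λ s c → c := (s :+ c) :- s) refl Σx (order · 1#) ⟩
    (Σx + order · 1#) - Σx                 ≡⟨ cong (_- Σx) (sym (sumList-+1 elems)) ⟩
    sumList (List.map (_+ 1#) elems) - Σx  ≡⟨ cong (_- Σx) (sumList-↭ (map-elems-↭ (_+ 1#) (_- 1#) minus-plus plus-minus)) ⟩
    Σx - Σx                                ≡⟨ -‿inverseʳ Σx ⟩
    0#                                     ∎
    where
    Σx = sumList elems
    minus-plus : ∀ x → (x - 1#) + 1# ≡ x
    plus-minus : ∀ x → (x + 1#) - 1# ≡ x
    minus-plus x = solve 2 (λ x o → (x :- o) :+ o := x) refl x 1#
    plus-minus x = solve 2 (λ x o → (x :+ o) :- o := x) refl x 1#

  unitPart : K → K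
  unitPart x with x ≟ 0#
  ... | yes _ = 1#
  ... | no _ = x

  unitPart≢0 : ∀ x → ¬ unitPart x ≡ 0#
  unitPart≢0 x with x ≟ 0#
  ... | yes _ = 1≢0
  ... | no x≢0 = x≢0

  #nonzero : List K → ℕ
  #nonzero [] = 0
  #nonzero (x ∷ xs) with x ≟ 0#
  ... | yes _ = #nonzero xs
  ... | no _ = suc (#nonzero xs)

  productList-unitPart≢0 : ∀ xs → ¬ productList (List.map unitPart xs) ≡ 0#
  productList-unitPart≢0 [] = 1≢0
  productList-unitPart≢0 (x ∷ xs) = *-nonzero (unitPart≢0 x) (productList-unitPart≢0 xs)

  productList-unitPart-scale : ∀ {c} → ¬ c ≡ 0# → ∀ xs →
    productList (List.map unitPart (List.map (c *_) xs)) ≡ c ^ #nonzero xs * productList (List.map unitPart xs)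
  productList-unitPart-scale c≢0 [] = sym (*-identityʳ _)
  productList-unitPart-scale {c} c≢0 (x ∷ xs) with x ≟ 0# | (c * x) ≟ 0#
  ... | yes _ | yes _ = trans (cong (1# *_) (productList-unitPart-scale c≢0 xs))
    (solve 3 (λ a b o → o :* (a :* b) := a :* (o :* b)) refl (c ^ #nonzero xs) _ 1#)
  ... | yes refl | no cx≢0 = ⊥-elim (cx≢0 (zeroʳ c))
  ... | no x≢0 | yes cx≡0 = ⊥-elim (*-nonzero c≢0 x≢0 cx≡0)
  ... | no _ | no _ = trans (cong ((c * x) *_) (productList-unitPart-scale c≢0 xs))
    (solve 4 (λ c x a b → (c :* x) :* (a :* b) := (c :* a) :* (x :* b)) refl c x (c ^ #nonzero xs) _)

  #nonzero-∉ : ∀ xs → 0# ∉ xs → #nonzero xs ≡ length xs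
  #nonzero-∉ [] _ = refl
  #nonzero-∉ (x ∷ xs) 0∉ with x ≟ 0#
  ... | yes x≡0 = ⊥-elim (0∉ (here (sym x≡0)))
  ... | no _ = cong suc (#nonzero-∉ xs (λ 0∈ → 0∉ (there 0∈)))

  #nonzero-∈ : ∀ xs → Unique xs → 0# ∈ xs → suc (#nonzero xs) ≡ length xs
  #nonzero-∈ (x ∷ xs) (x∉xs ∷ _) 0∈ with x ≟ 0#
  ... | yes x≡0 = cong suc (#nonzero-∉ xs (λ 0∈xs → All.lookup x∉xs 0∈xs x≡0))
  #nonzero-∈ (x ∷ xs) _ (here 0≡x) | no x≢0 = ⊥-elim (x≢0 (sym 0≡x))
  #nonzero-∈ (x ∷ xs) (_ ∷ u) (there 0∈) | no _ = cong suc (#nonzero-∈ xs u 0∈)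

  -- Multiplication by x ≢ 0 permutes the elements, which fixes the product of their unit parts.
  x^#nonzero≡1 : ∀ {x} → ¬ x ≡ 0# → x ^ #nonzero elems ≡ 1#
  x^#nonzero≡1 {x} x≢0 = *-cancelˡ P (productList-unitPart≢0 elems) (begin
    P * x ^ #nonzero elems                                       ≡⟨ *-comm P _ ⟩
    x ^ #nonzero elems * P                                       ≡⟨ sym (productList-unitPart-scale x≢0 elems) ⟩
    productList (List.map unitPart (List.map (x *_) elems))      ≡⟨ productList-↭ (↭.map⁺ unitPart x*-permutes) ⟩
    P                                                            ≡⟨ sym (*-identityʳ P) ⟩
    P * 1#                                                       ∎)
    where
    P = productList (List.map unitPart elems)
    x′ = x ⁻¹⟨ x≢0 ⟩
    x*-permutes : List.map (x *_) elems ↭ elems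
    x*-permutes = map-elems-↭ (x *_) (x′ *_)
      (λ y → trans (sym (*-assoc x x′ y)) (trans (cong (_* y) (*-inverseʳ x x≢0)) (*-identityˡ y)))
      (λ y → trans (sym (*-assoc x′ x y)) (trans (cong (_* y) (*-inverseˡ x x≢0)) (*-identityˡ y)))

  x^order≡x : ∀ x → x ^ order ≡ x
  x^order≡x x = trans (cong (x ^_) (sym (#nonzero-∈ elems unique (complete 0#)))) (x^suc#nonzero≡x x)
    where
    x^suc#nonzero≡x : ∀ x → x * x ^ #nonzero elems ≡ x
    x^suc#nonzero≡x x with x ≟ 0#
    ... | yes refl = zeroˡ _
    ... | no x≢0 = trans (cong (x *_) (x^#nonzero≡1 x≢0)) (*-identityʳ x)

  import Algebra.Definitions.RawMonoid (CommutativeRing.+-rawMonoid ring) as ΣStd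
  import Algebra.Properties.Semiring.Exp semiring as ^Std
  import Algebra.Properties.CommutativeSemiring.Binomial commutativeSemiring as Binomial

  ^≡^Std : ∀ x n → x ^ n ≡ x ^Std.^ n
  ^≡^Std x zero = refl
  ^≡^Std x (suc n) = cong (x *_) (^≡^Std x n)

  sumFin≡sumStd : ∀ n (f : Fin n → K) → sumFin f ≡ ΣStd.sum f
  sumFin≡sumStd zero f = refl
  sumFin≡sumStd (suc n) f = cong (f zero +_) (sumFin≡sumStd n (λ i → f (suc i)))

  -- In the binomial expansion of (x + y) ^ p only the two outer coefficients are not divisible by p.
  freshman's-dream : ∀ {p} → Prime p → p · 1# ≡ 0# → ∀ x y → (x + y) ^ p ≡ x ^ p + y ^ p
  freshman's-dream {suc p′} p-prime p≡0 x y = begin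
    (x + y) ^ p
      ≡⟨ ^≡^Std (x + y) p ⟩
    (x + y) ^Std.^ p
      ≡⟨ Binomial.theorem p x y ⟩
    ΣStd.sum (Binomial.binomialTerm x y p)
      ≡⟨ sym (sumFin≡sumStd (suc p) T) ⟩
    sumFin T
      ≡⟨ cong (T zero +_) (sumFin-last p′ (λ k → T (suc k))) ⟩
    T zero + (sumFin (λ i → T (suc (Fin.inject₁ i))) + T (suc (Fin.fromℕ p′)))
                                                  ≡⟨ cong₂ (λ u v → T zero + (u + v)) (sumFin-zero inner-term≡0) last-term ⟩
    T zero + (0# + x ^Std.^ p)
      ≡⟨ cong (_+ (0# + x ^Std.^ p)) first-term ⟩
    y ^Std.^ p + (0# + x ^Std.^ p)
      ≡⟨ solve 2 (λ a b → b :+ (con ℤ.0ℤ :+ a) := a :+ b) refl (x ^Std.^ p) (y ^Std.^ p) ⟩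
    x ^Std.^ p + y ^Std.^ p
      ≡⟨ sym (cong₂ _+_ (^≡^Std x p) (^≡^Std y p)) ⟩
    x ^ p + y ^ p ∎
    where
    p = suc p′
    T = Binomial.binomialTerm x y p
    first-term : T zero ≡ y ^Std.^ p
    first-term = trans (+-identityʳ _) (*-identityˡ _)
    last-term : T (suc (Fin.fromℕ p′)) ≡ x ^Std.^ p
    last-term = begin
      T (suc (Fin.fromℕ p′))                           ≡⟨ cong (λ k → (p C suc k) · (x ^Std.^ suc k * y ^Std.^ (p′ ℕ.∸ k))) (Fin.toℕ-fromℕ p′) ⟩
      (p C p) · (x ^Std.^ p * y ^Std.^ (p′ ℕ.∸ p′))   ≡⟨ cong₂ (λ c k → c · (x ^Std.^ p * y ^Std.^ k)) (nCn≡1 p) (ℕ.n∸n≡0 p′) ⟩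
      1 · (x ^Std.^ p * 1#)                            ≡⟨ trans (+-identityʳ _) (*-identityʳ _) ⟩
      x ^Std.^ p                                       ∎
    inner-term≡0 : ∀ i → T (suc (Fin.inject₁ i)) ≡ 0#
    inner-term≡0 i with prime∣pCk p-prime (ℕ.s≤s ℕ.z≤n) (ℕ.s≤s (subst (ℕ._< p′) (sym (Fin.toℕ-inject₁ i)) (Fin.toℕ<n i)))
    ... | divides t pCk≡t*p = begin
      (p C k) · z                ≡⟨ cong (_· z) pCk≡t*p ⟩
      (t ℕ.* p) · z              ≡⟨ sym (×-assocˡ z t p) ⟩
      t · (p · z)                ≡⟨ cong (t ·_) (trans (cong (p ·_) (sym (*-identityˡ z))) (sym (×-assoc-* p 1# z))) ⟩
      t · (p · 1# * z)           ≡⟨ cong (λ c → t · (c * z)) p≡0 ⟩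
      t · (0# * z)               ≡⟨ cong (t ·_) (zeroˡ z) ⟩
      t · 0#                     ≡⟨ ×-homo-0# t ⟩
      0#                         ∎
      where
      open import Algebra.Properties.Semiring.Mult semiring using (×-assocˡ; ×-assoc-*)
      k = Fin.toℕ (suc (Fin.inject₁ i))
      z = x ^Std.^ k * y ^Std.^ (p ℕ.∸ k)
      ×-homo-0# : ∀ t → t · 0# ≡ 0#
      ×-homo-0# zero = refl
      ×-homo-0# (suc t) = trans (+-identityˡ _) (×-homo-0# t)

  data Monic : ℕ → (K → K) → Set where
    one : ∀ {f} → (∀ x → f x ≡ 1#) → Monic 0 f
    horner : ∀ {D f g} → Monic D g → ∀ a → (∀ x → f x ≡ x * g x + a) → Monic (suc D) f

  divide-by-root : ∀ {D f} → Monic (suc D) f → ∀ r → Σ (K → K) λ g → Monic D g × (∀ x → f x ≡ (x - r) * g x + f r)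
  divide-by-root {zero} {f} (horner {g = g} (one g≡1) a f≡) r = (λ _ → 1#) , one (λ _ → refl) , λ x → begin
    f x                                  ≡⟨ f≡ x ⟩
    x * g x + a                          ≡⟨ cong (λ z → x * z + a) (g≡1 x) ⟩
    x * 1# + a                           ≡⟨ solve 4 (λ x r a o → x :* o :+ a := (x :- r) :* o :+ (r :* o :+ a)) refl x r a 1# ⟩
    (x - r) * 1# + (r * 1# + a)          ≡⟨ cong (λ z → (x - r) * 1# + (r * z + a)) (sym (g≡1 r)) ⟩
    (x - r) * 1# + (r * g r + a)         ≡⟨ cong ((x - r) * 1# +_) (sym (f≡ r)) ⟩
    (x - r) * 1# + f r                   ∎
  divide-by-root {suc D} {f} (horner {g = g} g-monic a f≡) r with divide-by-root g-monic r
  ... | h , h-monic , g≡ = (λ x → x * h x + g r) , horner h-monic (g r) (λ _ → refl) , λ x → begin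
    f x
      ≡⟨ f≡ x ⟩
    x * g x + a
      ≡⟨ cong (λ z → x * z + a) (g≡ x) ⟩
    x * ((x - r) * h x + g r) + a
      ≡⟨ solve 5 (λ x r h G a → x :* ((x :- r) :* h :+ G) :+ a := (x :- r) :* (x :* h :+ G) :+ (r :* G :+ a)) refl x r (h x) (g r) a ⟩
    (x - r) * (x * h x + g r) + (r * g r + a)
      ≡⟨ cong ((x - r) * (x * h x + g r) +_) (sym (f≡ r)) ⟩
    (x - r) * (x * h x + g r) + f r ∎

  #roots≤degree : ∀ {D f} → Monic D f → (rs : List K) → Unique rs → All (λ r → f r ≡ 0#) rs → length rs ℕ.≤ D
  #roots≤degree _ [] _ _ = ℕ.z≤n
  #roots≤degree (one f≡1) (r ∷ _) _ (fr≡0 ∷ _) = ⊥-elim (1≢0 (trans (sym (f≡1 r)) fr≡0))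
  #roots≤degree {suc D} {f} f-monic@(horner _ _ _) (r ∷ rs) (r∉rs ∷ rs-unique) (fr≡0 ∷ f[rs]≡0)
    with divide-by-root f-monic r
  ... | g , g-monic , f≡ = ℕ.s≤s (#roots≤degree g-monic rs rs-unique (All.zipWith (λ (r≢s , fs≡0) → g-root r≢s fs≡0) (r∉rs , f[rs]≡0)))
    where
    g-root : ∀ {s} → ¬ r ≡ s → f s ≡ 0# → g s ≡ 0#
    g-root {s} r≢s fs≡0 with zero-product (s - r) (g s) (begin
        (s - r) * g s          ≡⟨ sym (+-identityʳ _) ⟩
        (s - r) * g s + 0#     ≡⟨ cong ((s - r) * g s +_) (sym fr≡0) ⟩
        (s - r) * g s + f r    ≡⟨ sym (f≡ s) ⟩
        f s                    ≡⟨ fs≡0 ⟩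
        0#                     ∎)
    ... | inj₁ s-r≡0 = ⊥-elim (r≢s (sym (x-y≡0⇒x≡y s-r≡0)))
    ... | inj₂ gs≡0 = gs≡0

  x^n-monic : ∀ n → Monic n (_^ n)
  x^n-monic zero = one (λ _ → refl)
  x^n-monic (suc n) = horner (x^n-monic n) 0# (λ x → sym (+-identityʳ _))

  x^[2+m]-x-monic : ∀ m → Monic (suc (suc m)) (λ x → x ^ suc (suc m) - x)
  x^[2+m]-x-monic m = horner (horner (x^n-monic m) (- 1#) (λ x → refl)) 0# λ x →
    trans (cong (λ z → x * x ^ suc m - z) (sym (*-identityʳ x)))
          (solve 3 (λ x y o → x :* y :- x :* o := x :* (y :- o) :+ con ℤ.0ℤ) refl x (x ^ suc m) 1#)

module Conjugation (F : FiniteField) (q : ℕ) (q-prime-power : IsPrimePower q)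
                   (order≡q² : FiniteField.order F ≡ q ℕ.^ 2) where
  open FieldProperties F
  open Over F q
  open FiniteFieldFacts F q
  open ≡-Reasoning

  p k : ℕ
  p = proj₁ q-prime-power
  k = proj₁ (proj₂ q-prime-power)
  p-prime : Prime p
  p-prime = proj₁ (proj₂ (proj₂ q-prime-power))
  q≡p^k : q ≡ p ℕ.^ k
  q≡p^k = proj₂ (proj₂ (proj₂ (proj₂ q-prime-power)))

  q≥2 : 2 ℕ.≤ q
  q≥2 = ℕ.≤-trans (ℕ.nonTrivial⇒n>1 p {{prime⇒nonTrivial p-prime}})
          (subst (p ℕ.≤_) (sym q≡p^k) (subst (ℕ._≤ p ℕ.^ k) (ℕ.*-identityʳ p)
            (ℕ.^-monoʳ-≤ p {{prime⇒nonZero p-prime}} (proj₁ (proj₂ (proj₂ (proj₂ q-prime-power)))))))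

  p·1≡0 : p · 1# ≡ 0#
  p·1≡0 = x^n≡0⇒x≡0 (p · 1#) (k ℕ.* 2) (begin
    (p · 1#) ^ (k ℕ.* 2)      ≡⟨ sym (·1-^ p (k ℕ.* 2)) ⟩
    (p ℕ.^ (k ℕ.* 2)) · 1#    ≡⟨ cong (_· 1#) (trans (sym (ℕ.^-*-assoc p k 2)) (trans (cong (ℕ._^ 2) (sym q≡p^k)) (sym order≡q²))) ⟩
    order · 1#                ≡⟨ order·1≡0 ⟩
    0#                        ∎)

  σ-+ : ∀ x y → σ (x + y) ≡ σ x + σ y
  σ-+ x y = subst (λ n → (x + y) ^ n ≡ x ^ n + y ^ n) (sym q≡p^k) (iterate k x y)
    where
    iterate : ∀ k x y → (x + y) ^ (p ℕ.^ k) ≡ x ^ (p ℕ.^ k) + y ^ (p ℕ.^ k)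
    iterate zero x y = trans (*-identityʳ _) (sym (cong₂ _+_ (*-identityʳ x) (*-identityʳ y)))
    iterate (suc k) x y = begin
      (x + y) ^ (p ℕ.* p ℕ.^ k)                   ≡⟨ ^-* (x + y) p (p ℕ.^ k) ⟩
      ((x + y) ^ p) ^ (p ℕ.^ k)                   ≡⟨ cong (_^ (p ℕ.^ k)) (freshman's-dream p-prime p·1≡0 x y) ⟩
      (x ^ p + y ^ p) ^ (p ℕ.^ k)                 ≡⟨ iterate k (x ^ p) (y ^ p) ⟩
      (x ^ p) ^ (p ℕ.^ k) + (y ^ p) ^ (p ℕ.^ k)   ≡⟨ sym (cong₂ _+_ (^-* x p (p ℕ.^ k)) (^-* y p (p ℕ.^ k))) ⟩
      x ^ (p ℕ.* p ℕ.^ k) + y ^ (p ℕ.* p ℕ.^ k)   ∎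

  σ-* : ∀ x y → σ (x * y) ≡ σ x * σ y
  σ-* x y = ^-distrib-* x y q

  σ-1 : σ 1# ≡ 1#
  σ-1 = 1^n≡1 q

  σ-0 : σ 0# ≡ 0#
  σ-0 = trans (cong (0# ^_) (sym (ℕ.m+[n∸m]≡n {1} (ℕ.≤-trans (ℕ.s≤s ℕ.z≤n) q≥2)))) (zeroˡ _)

  σ-involutive : ∀ x → σ (σ x) ≡ x
  σ-involutive x = begin
    (x ^ q) ^ q       ≡⟨ sym (^-* x q q) ⟩
    x ^ (q ℕ.* q)     ≡⟨ cong (x ^_) (trans (cong (q ℕ.*_) (sym (ℕ.*-identityʳ q))) (sym order≡q²)) ⟩
    x ^ order         ≡⟨ x^order≡x x ⟩
    x                 ∎

  σ-neg : ∀ x → σ (- x) ≡ - σ x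
  σ-neg x = begin
    σ (- x)                  ≡⟨ solve 2 (λ a b → a := (a :+ b) :- b) refl (σ (- x)) (σ x) ⟩
    (σ (- x) + σ x) - σ x    ≡⟨ cong (_- σ x) (sym (σ-+ (- x) x)) ⟩
    σ (- x + x) - σ x        ≡⟨ cong (λ z → σ z - σ x) (-‿inverseˡ x) ⟩
    σ 0# - σ x               ≡⟨ cong (_- σ x) σ-0 ⟩
    0# - σ x                 ≡⟨ +-identityˡ _ ⟩
    - σ x                    ∎

  -- Every element fixed by σ is a root of x ^ q − x, which has at most q < q² roots.
  σ-nontrivial : Σ K λ ω → ¬ σ ω ≡ ω
  σ-nontrivial with Any.any? (λ x → ¬? (σ x ≟ x)) elems
  ... | yes moved = Any.satisfied moved
  ... | no none-moved = ⊥-elim (ℕ.<⇒≱ q<order (subst (length elems ℕ.≤_) 2+m≡q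
        (#roots≤degree (x^[2+m]-x-monic m) elems unique all-roots)))
    where
    m = q ℕ.∸ 2
    2+m≡q : suc (suc m) ≡ q
    2+m≡q = ℕ.m+[n∸m]≡n q≥2
    σ-fixes : ∀ x → σ x ≡ x
    σ-fixes x = decidable-stable (σ x ≟ x) (λ σx≢x → none-moved (Any.map (λ { refl → σx≢x }) (complete x)))
    all-roots : All (λ r → r ^ suc (suc m) - r ≡ 0#) elems
    all-roots = All.tabulate (λ {x} _ → trans (cong (λ n → x ^ n - x) 2+m≡q) (trans (cong (_- x) (σ-fixes x)) (-‿inverseʳ x)))
    q<order : q ℕ.< order
    q<order = subst (q ℕ.<_) (sym (trans order≡q² (cong (q ℕ.*_) (ℕ.*-identityʳ q))))
                (ℕ.m<m*n q q {{ℕ.>-nonZero (ℕ.<-≤-trans (ℕ.s≤s ℕ.z≤n) q≥2)}} q≥2)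

module LinearAlgebra (F : FiniteField) (q : ℕ) where
  open FieldProperties F
  open Over F q
  open Sums F q
  open ≡-Reasoning

  record IsSubfield (P : K → Set) : Set where
    field
      0∈ : P 0#
      1∈ : P 1#
      +∈ : ∀ {x y} → P x → P y → P (x + y)
      -∈ : ∀ {x} → P x → P (- x)
      *∈ : ∀ {x y} → P x → P y → P (x * y)
      ⁻¹∈ : ∀ {x} → P x → (x≢0 : ¬ x ≡ 0#) → P (x ⁻¹⟨ x≢0 ⟩)

  insertAt-∀ : ∀ {P : K → Set} {n} (xs : Fin n → K) i v → (∀ j → P (xs j)) → P v → ∀ j → P (insertAt xs i v j)
  insertAt-∀ xs zero v Pxs Pv zero = Pv
  insertAt-∀ xs zero v Pxs Pv (suc j) = Pxs j
  insertAt-∀ {n = suc n} xs (suc i) v Pxs Pv zero = Pxs zero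
  insertAt-∀ {n = suc n} xs (suc i) v Pxs Pv (suc j) = insertAt-∀ (λ k → xs (suc k)) i v (λ k → Pxs (suc k)) Pv j

  sumFin-insertAt : ∀ {m} (y : Fin m → K) i v (f : Fin (suc m) → K) →
                    sumFin (λ j → insertAt y i v j * f j) ≡ v * f i + sumFin (λ k → y k * f (Fin.punchIn i k))
  sumFin-insertAt y i v f = trans (sumFin-punchIn i (λ j → insertAt y i v j * f j))
    (cong₂ _+_ (cong (_* f i) (insertAt-lookup y i v)) (sumFin-cong (λ k → cong (_* f (Fin.punchIn i k)) (insertAt-punchIn y i v k))))

  HasDim-⇔ : ∀ {I : Set} {T T′ : (I → K) → Set} {P : K → Set} {m} → HasDim T P m → (∀ x → T x → T′ x) → (∀ x → T′ x → T x) → HasDim T′ P m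
  HasDim-⇔ (β , β∈T , independent , spans) T⊆T′ T′⊆T = β , (λ t → T⊆T′ (β t) (β∈T t)) , independent , λ x x∈T′ → spans x (T′⊆T x x∈T′)

  record LinearMap (I J : Set) : Set where
    field
      apply : (I → K) → (J → K)
      apply-cong : ∀ {x x′} → (∀ i → x i ≡ x′ i) → ∀ j → apply x j ≡ apply x′ j
      apply-lin : ∀ {d} (c : Fin d → K) (β : Fin d → I → K) → ∀ j → apply (lin c β) j ≡ lin c (λ t → apply (β t)) j

  HasDim-transport : ∀ {I J : Set} {S : K → Set} {T : (I → K) → Set} {T′ : (J → K) → Set} {m} (φ : LinearMap I J) (ψ : LinearMap J I) →
    (∀ x → T x → T′ (LinearMap.apply φ x)) → (∀ y → T′ y → T (LinearMap.apply ψ y)) →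
    (∀ x i → LinearMap.apply ψ (LinearMap.apply φ x) i ≡ x i) → (∀ y → T′ y → ∀ j → LinearMap.apply φ (LinearMap.apply ψ y) j ≡ y j) →
    HasDim T S m → HasDim T′ S m
  HasDim-transport {S = S} {T′ = T′} {m} φ ψ φ-maps ψ-maps ψ∘φ φ∘ψ (β , β∈T , β-independent , β-spans) =
    (λ t → φ.apply (β t)) , (λ t → φ-maps (β t) (β∈T t)) , independent , spans
    where
    module φ = LinearMap φ
    module ψ = LinearMap ψ
    independent : ∀ (c : Fin m → K) → (∀ t → S (c t)) → (∀ j → lin c (λ t → φ.apply (β t)) j ≡ 0#) → ∀ t → c t ≡ 0#
    independent c c∈ lin≡0 = β-independent c c∈ λ i → begin
      lin c β i                                  ≡⟨ sym (ψ∘φ (lin c β) i) ⟩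
      ψ.apply (φ.apply (lin c β)) i              ≡⟨ ψ.apply-cong (λ j → trans (φ.apply-lin c β j) (lin≡0 j)) i ⟩
      ψ.apply (lin {d = 0} (λ ()) (λ ())) i      ≡⟨ ψ.apply-lin {d = 0} (λ ()) (λ ()) i ⟩
      0#                                         ∎
    spans : ∀ y → T′ y → Σ (Fin m → K) λ c → (∀ t → S (c t)) × (∀ j → y j ≡ lin c (λ t → φ.apply (β t)) j)
    spans y y∈ with β-spans (ψ.apply y) (ψ-maps y y∈)
    ... | c , c∈ , ψy≡ = c , c∈ , λ j → begin
      y j                           ≡⟨ sym (φ∘ψ y y∈ j) ⟩
      φ.apply (ψ.apply y) j         ≡⟨ φ.apply-cong ψy≡ j ⟩
      φ.apply (lin c β) j           ≡⟨ φ.apply-lin c β j ⟩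
      lin c (λ t → φ.apply (β t)) j ∎

  lin-relation : ∀ {I : Set} {m m′} (β : Fin m → I → K) (β′ : Fin m′ → I → K) (c : Fin m → Fin m′ → K) →
                 (∀ i t → β i t ≡ lin (c i) β′ t) →
                 ∀ x → (∀ j → sumFin (λ i → x i * c i j) ≡ 0#) → ∀ t → lin x β t ≡ 0#
  lin-relation {m = m} {m′} β β′ c β≡ x relation t = begin
    sumFin (λ i → x i * β i t)
      ≡⟨ sumFin-cong (λ i → cong (x i *_) (β≡ i t)) ⟩
    sumFin (λ i → x i * sumFin (λ j → c i j * β′ j t))
      ≡⟨ sumFin-cong (λ i → *-distribˡ-sumFin {m′} (x i) _) ⟩
    sumFin (λ i → sumFin (λ j → x i * (c i j * β′ j t)))
      ≡⟨ sumFin-swap {m} {m′} _ ⟩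
    sumFin (λ j → sumFin (λ i → x i * (c i j * β′ j t)))
      ≡⟨ sumFin-cong (λ j → trans (sumFin-cong (λ i → sym (*-assoc (x i) (c i j) (β′ j t)))) (sym (*-distribʳ-sumFin {m} (β′ j t) _))) ⟩
    sumFin (λ j → sumFin (λ i → x i * c i j) * β′ j t)
      ≡⟨ sumFin-zero (λ j → trans (cong (_* β′ j t) (relation j)) (zeroˡ _)) ⟩
    0# ∎

  module _ {P : K → Set} (P-subfield : IsSubfield P) where
    open IsSubfield P-subfield

    δ∈ : ∀ {m} (i j : Fin m) → P (δ i j)
    δ∈ zero zero = 1∈
    δ∈ zero (suc j) = 0∈
    δ∈ (suc i) zero = 0∈
    δ∈ (suc i) (suc j) = δ∈ i j

    sumFin∈ : ∀ {m} (f : Fin m → K) → (∀ i → P (f i)) → P (sumFin f)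
    sumFin∈ {zero} f Pf = 0∈
    sumFin∈ {suc m} f Pf = +∈ (Pf zero) (sumFin∈ (λ i → f (suc i)) (λ i → Pf (suc i)))

    NontrivialRelation : ∀ {m e} → (Fin m → Fin e → K) → Set
    NontrivialRelation {m} c = Σ (Fin m → K) λ x → (∀ i → P (x i)) × (Σ (Fin m) λ i → ¬ x i ≡ 0#)
                                                  × (∀ j → sumFin (λ i → x i * c i j) ≡ 0#)

    -- Gaussian elimination on the first coordinate, using the vector c i₀ as pivot.
    eliminate-pivot : ∀ {e m} (c : Fin (suc m) → Fin (suc e) → K) i₀ (π≢0 : ¬ c i₀ zero ≡ 0#) →
      (∀ i j → P (c i j)) →
      NontrivialRelation (λ k j → c (Fin.punchIn i₀ k) (suc j) - (c (Fin.punchIn i₀ k) zero * c i₀ zero ⁻¹⟨ π≢0 ⟩) * c i₀ (suc j)) →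
      NontrivialRelation c
    eliminate-pivot {e} {m} c i₀ π≢0 Pc (y , Py , (k₀ , yk₀≢0) , y-relation) =
      x , insertAt-∀ {P = P} y i₀ x₀ Py Px₀ , (Fin.punchIn i₀ k₀ , λ x≡0 → yk₀≢0 (trans (sym (insertAt-punchIn y i₀ x₀ k₀)) x≡0)) , relation
      where
      π = c i₀ zero
      π′ = π ⁻¹⟨ π≢0 ⟩
      c′ : Fin m → Fin (suc e) → K
      c′ k = c (Fin.punchIn i₀ k)
      s = sumFin (λ k → y k * c′ k zero)
      x₀ = - (s * π′)
      x = insertAt y i₀ x₀
      Px₀ : P x₀
      Px₀ = -∈ (*∈ (sumFin∈ {m} _ (λ k → *∈ (Py k) (Pc _ _))) (⁻¹∈ (Pc _ _) π≢0))
      relation : ∀ j → sumFin (λ i → x i * c i j) ≡ 0#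
      relation zero = begin
        sumFin (λ i → x i * c i zero)          ≡⟨ sumFin-insertAt y i₀ x₀ (λ i → c i zero) ⟩
        x₀ * π + s                             ≡⟨ solve 3 (λ s i p → :- (s :* i) :* p :+ s := s :* (con ℤ.1ℤ :- i :* p)) refl s π′ π ⟩
        s * (fromℤ ℤ.1ℤ - π′ * π)              ≡⟨ cong (λ z → s * (z - π′ * π)) (+-identityʳ 1#) ⟩
        s * (1# - π′ * π)                      ≡⟨ cong (λ z → s * (1# - z)) (*-inverseˡ π π≢0) ⟩
        s * (1# - 1#)                          ≡⟨ trans (cong (s *_) (-‿inverseʳ 1#)) (zeroʳ s) ⟩
        0#                                     ∎
      relation (suc j) = begin
        sumFin (λ i → x i * c i (suc j))                            ≡⟨ sumFin-insertAt y i₀ x₀ (λ i → c i (suc j)) ⟩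
        x₀ * t + sumFin (λ k → y k * c′ k (suc j))                   ≡⟨ cong (x₀ * t +_) (sumFin-cong {m} (λ k → solve 5
                                                                         (λ y a b i t → y :* a := y :* (a :- (b :* i) :* t) :+ (y :* b) :* (i :* t))
                                                                         refl (y k) (c′ k (suc j)) (c′ k zero) π′ t)) ⟩
        x₀ * t + sumFin (λ k → y k * d k + (y k * c′ k zero) * (π′ * t))
                                                                    ≡⟨ cong (x₀ * t +_) (sumFin-+ {m} _ _) ⟩
        x₀ * t + (sumFin (λ k → y k * d k) + sumFin (λ k → (y k * c′ k zero) * (π′ * t)))
                                                                    ≡⟨ cong₂ (λ u v → x₀ * t + (u + v)) (y-relation j) (sym (*-distribʳ-sumFin {m} (π′ * t) _)) ⟩
        x₀ * t + (0# + s * (π′ * t))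
          ≡⟨ solve 3 (λ s i t → :- (s :* i) :* t :+ (con ℤ.0ℤ :+ s :* (i :* t)) := con ℤ.0ℤ) refl s π′ t ⟩
        0# ∎
        where
        t = c i₀ (suc j)
        d : Fin m → K
        d k = c′ k (suc j) - (c′ k zero * π′) * t

    more-vectors-than-coordinates : ∀ {e m} → e ℕ.< m → (c : Fin m → Fin e → K) → (∀ i j → P (c i j)) → NontrivialRelation c
    more-vectors-than-coordinates {zero} {suc m} _ c Pc = δ zero , δ∈ zero , (zero , 1≢0) , λ ()
    more-vectors-than-coordinates {suc e} {suc m} (ℕ.s≤s e<m) c Pc with Fin.any? (λ i → ¬? (c i zero ≟ 0#))
    ... | yes (i₀ , π≢0) = eliminate-pivot c i₀ π≢0 Pc
          (more-vectors-than-coordinates e<m _ (λ k j → +∈ (Pc _ _) (-∈ (*∈ (*∈ (Pc _ _) (⁻¹∈ (Pc _ _) π≢0)) (Pc _ _)))))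
    ... | no no-pivot with more-vectors-than-coordinates (ℕ.m<n⇒m<1+n e<m) (λ i j → c i (suc j)) (λ i j → Pc i (suc j))
    ...   | x , Px , x≢0 , relation = x , Px , x≢0 , λ where
              zero → sumFin-zero (λ i → trans (cong (x i *_) (column₀≡0 i)) (zeroʳ _))
              (suc j) → relation j
      where
      column₀≡0 : ∀ i → c i zero ≡ 0#
      column₀≡0 i = decidable-stable (c i zero ≟ 0#) (λ ci≢0 → no-pivot (i , ci≢0))

    HasDim-≤ : ∀ {I : Set} {T : (I → K) → Set} {m m′} → HasDim T P m → HasDim T P m′ → m ℕ.≤ m′
    HasDim-≤ {T = T} {m} {m′} (β , βT , β-independent , _) (β′ , _ , _ , β′-spans) with m ℕ.≤? m′
    ... | yes m≤m′ = m≤m′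
    ... | no m≰m′ with more-vectors-than-coordinates (ℕ.≰⇒> m≰m′) (λ i → proj₁ (β′-spans (β i) (βT i)))
                         (λ i → proj₁ (proj₂ (β′-spans (β i) (βT i))))
    ...   | x , Px , (i , xi≢0) , relation = ⊥-elim (xi≢0 (β-independent x Px
              (lin-relation β β′ _ (λ i → proj₂ (proj₂ (β′-spans (β i) (βT i)))) x relation) i))

    HasDim-unique : ∀ {I : Set} {T : (I → K) → Set} {m m′} → HasDim T P m → HasDim T P m′ → m ≡ m′
    HasDim-unique h h′ = ℕ.≤-antisym (HasDim-≤ h h′) (HasDim-≤ h′ h)

module Orthogonality (F : FiniteField) (q : ℕ) (n : ℕ) where
  open FieldProperties F
  open Over F q
  open Sums F q
  open Dim n
  open ≡-Reasoning

  dot-+* : ∀ (x : E) a (u v : E) → dot x (λ l → a * u l + v l) ≡ a * dot x u + dot x v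
  dot-+* x a u v = begin
    sumFin (λ l → x l * (a * u l + v l))
      ≡⟨ sumFin-cong (λ l → solve 4 (λ x a u v → x :* (a :* u :+ v) := a :* (x :* u) :+ x :* v) refl (x l) a (u l) (v l)) ⟩
    sumFin (λ l → a * (x l * u l) + x l * v l)
      ≡⟨ sumFin-+ {n} _ _ ⟩
    sumFin (λ l → a * (x l * u l)) + dot x v
      ≡⟨ cong (_+ dot x v) (sym (*-distribˡ-sumFin a (λ l → x l * u l))) ⟩
    a * dot x u + dot x v ∎

  dot-* : ∀ (x : E) a (u : E) → dot x (λ l → a * u l) ≡ a * dot x u
  dot-* x a u = trans (sumFin-cong (λ l → solve 3 (λ x a u → x :* (a :* u) := a :* (x :* u)) refl (x l) a (u l)))
                      (sym (*-distribˡ-sumFin a (λ l → x l * u l)))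

  dot-lin : ∀ {w} (c : Fin w → K) (b : Fin w → E) (y : E) → dot (lin c b) y ≡ sumFin (λ k → c k * dot (b k) y)
  dot-lin {w} c b y = begin
    sumFin (λ l → sumFin (λ k → c k * b k l) * y l)
      ≡⟨ sumFin-cong (λ l → *-distribʳ-sumFin (y l) (λ k → c k * b k l)) ⟩
    sumFin (λ l → sumFin (λ k → c k * b k l * y l))
      ≡⟨ sumFin-swap (λ l k → c k * b k l * y l) ⟩
    sumFin (λ k → sumFin (λ l → c k * b k l * y l))
      ≡⟨ sumFin-cong (λ k → trans (sumFin-cong {n} (λ l → *-assoc (c k) (b k l) (y l))) (sym (*-distribˡ-sumFin (c k) (λ l → b k l * y l)))) ⟩
    sumFin (λ k → c k * dot (b k) y) ∎

  dot-δ : ∀ (x : E) j → dot x (δ j) ≡ x j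
  dot-δ x j = trans (sumFin-cong (λ l → *-comm (x l) (δ j l))) (sumFin-δ j x)

  Independent : ∀ {w} → (Fin w → E) → Set
  Independent {w} b = ∀ (c : Fin w → K) → (∀ l → lin c b l ≡ 0#) → ∀ j → c j ≡ 0#

  Independent-tail : ∀ {w} {b : Fin (suc w) → E} → Independent b → Independent (λ k → b (suc k))
  Independent-tail {b = b} b-independent c c-relation j = b-independent (λ { zero → 0# ; (suc k) → c k })
    (λ l → trans (cong (_+ lin c (λ k → b (suc k)) l) (zeroˡ _)) (trans (+-identityˡ _) (c-relation l))) (suc j)

  Dual : ∀ {w} → (Fin w → E) → (Fin w → E) → Set
  Dual b e = ∀ i j → dot (b i) (e j) ≡ δ i j

  module DualStep {w} (b : Fin (suc w) → E) (e′ : Fin w → E) (e′-dual : Dual (λ k → b (suc k)) e′) where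
    -- y j is the j-th unit vector made orthogonal to b 1, …, b w.
    y : Fin n → E
    y j l = δ j l - sumFin (λ k → b (suc k) j * e′ k l)

    dot-y : ∀ (x : E) j → dot x (y j) ≡ x j - sumFin (λ k → b (suc k) j * dot x (e′ k))
    dot-y x j = begin
      dot x (y j)
        ≡⟨ sumFin-cong (λ l → solve 3 (λ x a s → x :* (a :- s) := x :* a :+ :- (x :* s)) refl (x l) (δ j l) _) ⟩
      sumFin (λ l → x l * δ j l + - (x l * sumFin (λ k → b (suc k) j * e′ k l)))
        ≡⟨ sumFin-+ {n} _ _ ⟩
      dot x (δ j) + sumFin (λ l → - (x l * sumFin (λ k → b (suc k) j * e′ k l)))
        ≡⟨ cong₂ _+_ (dot-δ x j) (sym (-‿sumFin {n} _)) ⟩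
      x j - dot x (λ l → sumFin (λ k → b (suc k) j * e′ k l))
        ≡⟨ cong (λ z → x j - z) (trans (dot-comm x _) (trans (dot-lin _ e′ x) (sumFin-cong (λ k → cong (b (suc k) j *_) (dot-comm (e′ k) x))))) ⟩
      x j - sumFin (λ k → b (suc k) j * dot x (e′ k)) ∎
      where
      dot-comm : ∀ u v → dot u v ≡ dot v u
      dot-comm u v = sumFin-cong (λ l → *-comm (u l) (v l))

    dot-b-suc-y : ∀ i j → dot (b (suc i)) (y j) ≡ 0#
    dot-b-suc-y i j = begin
      dot (b (suc i)) (y j)
        ≡⟨ dot-y (b (suc i)) j ⟩
      b (suc i) j - sumFin (λ k → b (suc k) j * dot (b (suc i)) (e′ k))
        ≡⟨ cong (λ z → b (suc i) j - z) (trans (sumFin-cong (λ k → trans (cong (b (suc k) j *_) (e′-dual i k)) (*-comm _ _))) (sumFin-δ i (λ k → b (suc k) j))) ⟩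
      b (suc i) j - b (suc i) j
        ≡⟨ -‿inverseʳ _ ⟩
      0# ∎

    -- If b 0 were orthogonal to every y j it would equal Σₖ ⟨b 0, e′ k⟩ b (k + 1).
    b₀-relation : Fin (suc w) → K
    b₀-relation zero = - 1#
    b₀-relation (suc k) = dot (b zero) (e′ k)

    b₀-orthogonal-dependent : (∀ j → dot (b zero) (y j) ≡ 0#) → ∀ l → lin b₀-relation b l ≡ 0#
    b₀-orthogonal-dependent b₀⊥y l = begin
      - 1# * b zero l + sumFin (λ k → dot (b zero) (e′ k) * b (suc k) l)
        ≡⟨ cong₂ _+_ (trans (sym (-‿distribˡ-* _ _)) (cong -_ (*-identityˡ _))) (sumFin-cong (λ k → *-comm (dot (b zero) (e′ k)) (b (suc k) l))) ⟩
      - b zero l + sumFin (λ k → b (suc k) l * dot (b zero) (e′ k))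
        ≡⟨ solve 2 (λ b s → :- b :+ s := :- (b :- s)) refl _ _ ⟩
      - (b zero l - sumFin (λ k → b (suc k) l * dot (b zero) (e′ k)))
        ≡⟨ cong -_ (trans (sym (dot-y (b zero) l)) (b₀⊥y l)) ⟩
      - 0#
        ≡⟨ -0#≈0# ⟩
      0# ∎

    extend : ∀ j₀ → ¬ dot (b zero) (y j₀) ≡ 0# → Σ (Fin (suc w) → E) (Dual b)
    extend j₀ t≢0 = e , e-dual
      where
      t′ = (dot (b zero) (y j₀)) ⁻¹⟨ t≢0 ⟩
      e₀ : E
      e₀ l = t′ * y j₀ l
      dot-b₀-e₀ : dot (b zero) e₀ ≡ 1#
      dot-b₀-e₀ = trans (dot-* (b zero) t′ (y j₀)) (*-inverseˡ _ t≢0)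
      dot-b-suc-e₀ : ∀ i → dot (b (suc i)) e₀ ≡ 0#
      dot-b-suc-e₀ i = trans (dot-* (b (suc i)) t′ (y j₀)) (trans (cong (t′ *_) (dot-b-suc-y i j₀)) (zeroʳ t′))
      e : Fin (suc w) → E
      e zero = e₀
      e (suc k) l = (- dot (b zero) (e′ k)) * e₀ l + e′ k l
      e-dual : Dual b e
      e-dual zero zero = dot-b₀-e₀
      e-dual (suc i) zero = dot-b-suc-e₀ i
      e-dual zero (suc k) = begin
        dot (b zero) (e (suc k))                              ≡⟨ dot-+* (b zero) _ e₀ (e′ k) ⟩
        (- dot (b zero) (e′ k)) * dot (b zero) e₀ + dot (b zero) (e′ k) ≡⟨ cong (λ z → (- dot (b zero) (e′ k)) * z + dot (b zero) (e′ k)) dot-b₀-e₀ ⟩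
        (- dot (b zero) (e′ k)) * 1# + dot (b zero) (e′ k)    ≡⟨ trans (cong (_+ dot (b zero) (e′ k)) (*-identityʳ _)) (-‿inverseˡ _) ⟩
        0#                                                    ∎
      e-dual (suc i) (suc k) = begin
        dot (b (suc i)) (e (suc k))                           ≡⟨ dot-+* (b (suc i)) _ e₀ (e′ k) ⟩
        (- dot (b zero) (e′ k)) * dot (b (suc i)) e₀ + dot (b (suc i)) (e′ k) ≡⟨ cong₂ (λ u v → (- dot (b zero) (e′ k)) * u + v) (dot-b-suc-e₀ i) (e′-dual i k) ⟩
        (- dot (b zero) (e′ k)) * 0# + δ i k                  ≡⟨ trans (cong (_+ δ i k) (zeroʳ _)) (+-identityˡ _) ⟩
        δ i k                                                 ∎

    extend-dual : Independent b → Σ (Fin (suc w) → E) (Dual b)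
    extend-dual b-independent with Fin.any? (λ j → ¬? (dot (b zero) (y j) ≟ 0#))
    ... | yes (j₀ , t≢0) = extend j₀ t≢0
    ... | no b₀-not-⊥ = ⊥-elim (1≢0 (begin
      1#                   ≡⟨ sym (-‿involutive 1#) ⟩
      - - 1#               ≡⟨ cong -_ (b-independent b₀-relation (b₀-orthogonal-dependent b₀⊥y) zero) ⟩
      - 0#                 ≡⟨ -0#≈0# ⟩
      0#                   ∎))
      where
      b₀⊥y : ∀ j → dot (b zero) (y j) ≡ 0#
      b₀⊥y j = decidable-stable (dot (b zero) (y j) ≟ 0#) (λ t≢0 → b₀-not-⊥ (j , t≢0))

  dual : ∀ {w} (b : Fin w → E) → Independent b → Σ (Fin w → E) (Dual b)
  dual {zero} b _ = (λ ()) , λ ()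
  dual {suc w} b b-independent with dual (λ k → b (suc k)) (Independent-tail {b = b} b-independent)
  ... | e′ , e′-dual = DualStep.extend-dual b e′ e′-dual b-independent

  ⊥-subspace : ∀ (U : E → Set) → IsSubspace (U ⊥)
  ⊥-subspace U = record
    { resp = λ x y x≡y x⊥U u u∈U → trans (sumFin-cong (λ i → cong (_* u i) (sym (x≡y i)))) (x⊥U u u∈U)
    ; zero∈ = λ u _ → sumFin-zero (λ i → zeroˡ (u i))
    ; +∈ = λ x y x⊥U y⊥U u u∈U → trans (trans (sumFin-cong (λ i → distribʳ (u i) (x i) (y i))) (sumFin-+ (λ i → x i * u i) (λ i → y i * u i)))
                                        (trans (cong₂ _+_ (x⊥U u u∈U) (y⊥U u u∈U)) (+-identityˡ 0#))
    ; *∈ = λ c x x⊥U u u∈U → trans (trans (sumFin-cong (λ i → *-assoc c (x i) (u i))) (sym (*-distribˡ-sumFin c (λ i → x i * u i))))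
                                    (trans (cong (c *_) (x⊥U u u∈U)) (zeroʳ c)) }

  ∩-subspace : ∀ {V W : E → Set} → IsSubspace V → IsSubspace W → IsSubspace (V ∩ W)
  ∩-subspace V-subspace W-subspace = record
    { resp = λ x y x≡y (x∈V , x∈W) → V.resp x y x≡y x∈V , W.resp x y x≡y x∈W
    ; zero∈ = V.zero∈ , W.zero∈
    ; +∈ = λ x y (x∈V , x∈W) (y∈V , y∈W) → V.+∈ x y x∈V y∈V , W.+∈ x y x∈W y∈W
    ; *∈ = λ c x (x∈V , x∈W) → V.*∈ c x x∈V , W.*∈ c x x∈W }
    where
    module V = IsSubspace V-subspace
    module W = IsSubspace W-subspace

module HermitianMatrices (F : FiniteField) (q : ℕ) where
  open FieldProperties F
  open Over F q
  open Sums F q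
  open LinearAlgebra F q
  open ≡-Reasoning

  Square : ℕ → Set
  Square m = Fin m × Fin m → K

  record Coordinates (S T : K → Set) : Set where
    field
      size : ℕ
      vector : Fin size → K
      vector∈ : ∀ t → T (vector t)
      coord : K → Fin size → K
      coord∈ : ∀ x → T x → ∀ t → S (coord x t)
      expand : ∀ x → T x → x ≡ sumFin (λ t → coord x t * vector t)
      coord-expand : ∀ (c : Fin size → K) → (∀ t → S (c t)) → ∀ t → coord (sumFin (λ t′ → c t′ * vector t′)) t ≡ c t

  -- Alt, Sym and Her are the matrices with M (j , i) ≡ ε * τ (M (i , j)) and admissible diagonal,
  -- for (τ, ε, Diagonal) = (id, −1, ≡ 0), (id, 1, anything) and (σ, 1, anything).
  record HermitianData (Scalar : K → Set) : Set₁ where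
    field
      scalar-subfield : IsSubfield Scalar
      τ : K → K
      τ-+ : ∀ x y → τ (x + y) ≡ τ x + τ y
      τ-* : ∀ x y → τ (x * y) ≡ τ x * τ y
      τ-1 : τ 1# ≡ 1#
      τ-involutive : ∀ x → τ (τ x) ≡ x
      τ-scalar : ∀ {c} → Scalar c → τ c ≡ c
      ε : K
      ε*ε≡1 : ε * ε ≡ 1#
      τε≡ε : τ ε ≡ ε
      Diagonal : K → Set
      Diagonal-0 : Diagonal 0#
      Diagonal-quadratic : ∀ {w} (x : Fin w → K) (Z : Square w) → (∀ i j → Z (j , i) ≡ ε * τ (Z (i , j))) →
                           (∀ i → Diagonal (Z (i , i))) → Diagonal (sumFin (λ i → sumFin (λ j → x i * Z (i , j) * τ (x j))))
      entry-coordinates : Coordinates Scalar (λ _ → ⊤)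
      diagonal-coordinates : Coordinates Scalar (λ x → x ≡ ε * τ x × Diagonal x)

  module Hermitian {Scalar : K → Set} (H : HermitianData Scalar) where
    open HermitianData H public
    open IsSubfield scalar-subfield

    τ-0 : τ 0# ≡ 0#
    τ-0 = begin
      τ 0#                  ≡⟨ solve 1 (λ a → a := (a :+ a) :- a) refl (τ 0#) ⟩
      (τ 0# + τ 0#) - τ 0#  ≡⟨ cong (_- τ 0#) (sym (τ-+ 0# 0#)) ⟩
      τ (0# + 0#) - τ 0#    ≡⟨ cong (λ z → τ z - τ 0#) (+-identityˡ 0#) ⟩
      τ 0# - τ 0#           ≡⟨ -‿inverseʳ _ ⟩
      0#                    ∎

    τ-sumFin : ∀ {m} (f : Fin m → K) → τ (sumFin f) ≡ sumFin (λ i → τ (f i))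
    τ-sumFin {zero} f = τ-0
    τ-sumFin {suc m} f = trans (τ-+ _ _) (cong (τ (f zero) +_) (τ-sumFin (λ i → f (suc i))))

    τ-δ : ∀ {m} (i j : Fin m) → τ (δ i j) ≡ δ i j
    τ-δ i j = τ-scalar (δ∈ scalar-subfield i j)

    twist : K → K
    twist x = ε * τ x

    twist-involutive : ∀ x → twist (twist x) ≡ x
    twist-involutive x = begin
      ε * τ (ε * τ x)        ≡⟨ cong (ε *_) (τ-* ε (τ x)) ⟩
      ε * (τ ε * τ (τ x))    ≡⟨ cong₂ (λ a b → ε * (a * b)) τε≡ε (τ-involutive x) ⟩
      ε * (ε * x)            ≡⟨ sym (*-assoc _ _ _) ⟩
      (ε * ε) * x            ≡⟨ cong (_* x) ε*ε≡1 ⟩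
      1# * x                 ≡⟨ *-identityˡ x ⟩
      x                      ∎

    twist-0 : twist 0# ≡ 0#
    twist-0 = trans (cong (ε *_) τ-0) (zeroʳ ε)

    twist-scalar-* : ∀ {c} x → Scalar c → twist (c * x) ≡ c * twist x
    twist-scalar-* {c} x c∈ = begin
      ε * τ (c * x)          ≡⟨ cong (ε *_) (τ-* c x) ⟩
      ε * (τ c * τ x)        ≡⟨ cong (λ z → ε * (z * τ x)) (τ-scalar c∈) ⟩
      ε * (c * τ x)          ≡⟨ solve 3 (λ e c t → e :* (c :* t) := c :* (e :* t)) refl ε c (τ x) ⟩
      c * (ε * τ x)          ∎

    twist-lin : ∀ {m} (c f : Fin m → K) → (∀ i → Scalar (c i)) → twist (sumFin (λ i → c i * f i)) ≡ sumFin (λ i → c i * twist (f i))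
    twist-lin {zero} c f c∈ = twist-0
    twist-lin {suc m} c f c∈ = trans (trans (cong (ε *_) (τ-+ _ _)) (distribˡ ε _ _))
      (cong₂ _+_ (twist-scalar-* (f zero) (c∈ zero)) (twist-lin (λ i → c (suc i)) (λ i → f (suc i)) (λ i → c∈ (suc i))))

    IsTwisted : ∀ {m} → Square m → Set
    IsTwisted M = ∀ i j → M (j , i) ≡ twist (M (i , j))

    IsHermitian : ∀ {m} → Square m → Set
    IsHermitian M = IsTwisted M × (∀ i → Diagonal (M (i , i)))

    congruence : ∀ {m m′} → (Fin m → Fin m′ → K) → Square m → Square m′
    congruence u M (a , b) = sumFin (λ i → sumFin (λ j → u i a * M (i , j) * τ (u j b)))

    congruence-cong : ∀ {m m′} {u u′ : Fin m → Fin m′ → K} {M M′ : Square m} →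
                      (∀ i a → u i a ≡ u′ i a) → (∀ p → M p ≡ M′ p) → ∀ p → congruence u M p ≡ congruence u′ M′ p
    congruence-cong {m} u≡ M≡ (a , b) = sumFin-cong {m} (λ i → sumFin-cong {m} (λ j →
      cong₂ (λ x y → x * y) (cong₂ _*_ (u≡ i a) (M≡ (i , j))) (cong τ (u≡ j b))))

    congruence-twisted : ∀ {m m′} (u : Fin m → Fin m′ → K) {M : Square m} → IsTwisted M → IsTwisted (congruence u M)
    congruence-twisted {m} u {M} M-twisted a b = begin
      sumFin (λ i → sumFin (λ j → u i b * M (i , j) * τ (u j a)))     ≡⟨ sumFin-swap (λ i j → u i b * M (i , j) * τ (u j a)) ⟩
      sumFin (λ j → sumFin (λ i → u i b * M (i , j) * τ (u j a)))     ≡⟨ sumFin-cong {m} (λ j → sumFin-cong {m} (λ i → term j i)) ⟩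
      sumFin (λ i → sumFin (λ j → ε * τ (T i j)))                     ≡⟨ sumFin-cong {m} (λ i → sym (*-distribˡ-sumFin ε (λ j → τ (T i j)))) ⟩
      sumFin (λ i → ε * sumFin (λ j → τ (T i j)))                     ≡⟨ sym (*-distribˡ-sumFin {m} ε _) ⟩
      ε * sumFin (λ i → sumFin (λ j → τ (T i j)))                     ≡⟨ cong (ε *_) (sym (trans (τ-sumFin {m} _) (sumFin-cong {m} (λ i → τ-sumFin (T i))))) ⟩
      ε * τ (sumFin (λ i → sumFin (λ j → T i j)))                     ∎
      where
      T : Fin m → Fin m → K
      T i j = u i a * M (i , j) * τ (u j b)
      term : ∀ i j → u j b * M (j , i) * τ (u i a) ≡ ε * τ (T i j)
      term i j = begin
        u j b * M (j , i) * τ (u i a)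
          ≡⟨ cong (λ z → u j b * z * τ (u i a)) (M-twisted i j) ⟩
        u j b * (ε * τ (M (i , j))) * τ (u i a)
          ≡⟨ solve 4 (λ x e t y → x :* (e :* t) :* y := e :* (y :* t :* x)) refl (u j b) ε (τ (M (i , j))) (τ (u i a)) ⟩
        ε * (τ (u i a) * τ (M (i , j)) * u j b)
          ≡⟨ cong (λ z → ε * (τ (u i a) * τ (M (i , j)) * z)) (sym (τ-involutive (u j b))) ⟩
        ε * (τ (u i a) * τ (M (i , j)) * τ (τ (u j b)))
          ≡⟨ cong (ε *_) (sym (trans (τ-* _ _) (cong (_* τ (τ (u j b))) (τ-* _ _)))) ⟩
        ε * τ (T i j) ∎

    congruence-hermitian : ∀ {m m′} (u : Fin m → Fin m′ → K) {M : Square m} → IsHermitian M → IsHermitian (congruence u M)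
    congruence-hermitian u {M} (M-twisted , M-diagonal) =
      congruence-twisted u M-twisted , λ a → Diagonal-quadratic (λ i → u i a) M M-twisted M-diagonal

    congruence-lin : ∀ {m m′ d} (u : Fin m → Fin m′ → K) (c : Fin d → K) (β : Fin d → Square m) →
                     ∀ p → congruence u (lin c β) p ≡ lin c (λ t → congruence u (β t)) p
    congruence-lin {m} {m′} {d} u c β (a , b) = begin
      sumFin (λ i → sumFin (λ j → u i a * sumFin (λ t → c t * β t (i , j)) * τ (u j b)))
        ≡⟨ sumFin-cong {m} (λ i → sumFin-cong {m} (λ j → pull-out i j)) ⟩
      sumFin (λ i → sumFin (λ j → sumFin (λ t → c t * (u i a * β t (i , j) * τ (u j b)))))
        ≡⟨ sumFin-cong {m} (λ i → sumFin-swap {m} {d} _) ⟩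
      sumFin (λ i → sumFin (λ t → sumFin (λ j → c t * (u i a * β t (i , j) * τ (u j b)))))
        ≡⟨ sumFin-swap {m} {d} _ ⟩
      sumFin (λ t → sumFin (λ i → sumFin (λ j → c t * (u i a * β t (i , j) * τ (u j b)))))
        ≡⟨ sumFin-cong {d} (λ t → trans (sumFin-cong {m} (λ i → sym (*-distribˡ-sumFin {m} (c t) _))) (sym (*-distribˡ-sumFin {m} (c t) _))) ⟩
      sumFin (λ t → c t * congruence u (β t) (a , b)) ∎
      where
      pull-out : ∀ i j → u i a * sumFin (λ t → c t * β t (i , j)) * τ (u j b) ≡ sumFin (λ t → c t * (u i a * β t (i , j) * τ (u j b)))
      pull-out i j = trans (cong (_* τ (u j b)) (*-distribˡ-sumFin {d} (u i a) _))
        (trans (*-distribʳ-sumFin {d} (τ (u j b)) _)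
          (sumFin-cong {d} (λ t → solve 4 (λ x c y z → x :* (c :* y) :* z := c :* (x :* y :* z)) refl (u i a) (c t) (β t (i , j)) (τ (u j b)))))

    congruence-δ : ∀ {m} (M : Square m) → ∀ p → congruence δ M p ≡ M p
    congruence-δ {m} M (a , b) = begin
      sumFin (λ i → sumFin (λ j → δ i a * M (i , j) * τ (δ j b)))
        ≡⟨ sumFin-cong {m} (λ i → sumFin-cong {m} (λ j → trans (cong (δ i a * M (i , j) *_) (τ-δ j b)) (*-assoc _ _ _))) ⟩
      sumFin (λ i → sumFin (λ j → δ i a * (M (i , j) * δ j b)))
        ≡⟨ sumFin-cong {m} (λ i → trans (sym (*-distribˡ-sumFin {m} (δ i a) _)) (cong (δ i a *_) (sumFin-δʳ b (λ j → M (i , j))))) ⟩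
      sumFin (λ i → δ i a * M (i , b))
        ≡⟨ trans (sumFin-cong {m} (λ i → cong (_* M (i , b)) (δ-sym i a))) (sumFin-δ a (λ i → M (i , b))) ⟩
      M (a , b) ∎

    congruence-∘ : ∀ {m m′ m″} (u : Fin m → Fin m′ → K) (v : Fin m′ → Fin m″ → K) (M : Square m) →
                   ∀ p → congruence v (congruence u M) p ≡ congruence (λ i a → sumFin (λ x → u i x * v x a)) M p
    congruence-∘ {m} {m′} {m″} u v M (a , b) = begin
      sumFin (λ x → sumFin (λ y → v x a * sumFin (λ i → sumFin (λ j → u i x * M (i , j) * τ (u j y))) * τ (v y b)))
        ≡⟨ sumFin-cong {m′} (λ x → sumFin-cong {m′} (λ y → expand-product x y)) ⟩
      sumFin (λ x → sumFin (λ y → sumFin (λ i → sumFin (λ j → T x y i j))))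
        ≡⟨ sumFin-cong {m′} (λ x → sumFin-swap {m′} {m} _) ⟩
      sumFin (λ x → sumFin (λ i → sumFin (λ y → sumFin (λ j → T x y i j))))
        ≡⟨ sumFin-swap {m′} {m} _ ⟩
      sumFin (λ i → sumFin (λ x → sumFin (λ y → sumFin (λ j → T x y i j))))
        ≡⟨ sumFin-cong {m} (λ i → sumFin-cong {m′} (λ x → sumFin-swap {m′} {m} _)) ⟩
      sumFin (λ i → sumFin (λ x → sumFin (λ j → sumFin (λ y → T x y i j))))
        ≡⟨ sumFin-cong {m} (λ i → sumFin-swap {m′} {m} _) ⟩
      sumFin (λ i → sumFin (λ j → sumFin (λ x → sumFin (λ y → T x y i j))))
        ≡⟨ sumFin-cong {m} (λ i → sumFin-cong {m} (λ j → sym (collect i j))) ⟩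
      sumFin (λ i → sumFin (λ j → sumFin (λ x → u i x * v x a) * M (i , j) * τ (sumFin (λ y → u j y * v y b)))) ∎
      where
      T : Fin m′ → Fin m′ → Fin m → Fin m → K
      T x y i j = u i x * v x a * M (i , j) * (τ (u j y) * τ (v y b))
      expand-product : ∀ x y → v x a * sumFin (λ i → sumFin (λ j → u i x * M (i , j) * τ (u j y))) * τ (v y b) ≡ sumFin (λ i → sumFin (λ j → T x y i j))
      expand-product x y = begin
        v x a * sumFin (λ i → sumFin (λ j → u i x * M (i , j) * τ (u j y))) * τ (v y b)
          ≡⟨ trans (cong (_* τ (v y b)) (*-distribˡ-sumFin {m} (v x a) _)) (*-distribʳ-sumFin {m} (τ (v y b)) _) ⟩
        sumFin (λ i → v x a * sumFin (λ j → u i x * M (i , j) * τ (u j y)) * τ (v y b))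
          ≡⟨ sumFin-cong {m} (λ i → trans (cong (_* τ (v y b)) (*-distribˡ-sumFin {m} (v x a) _)) (*-distribʳ-sumFin {m} (τ (v y b)) _)) ⟩
        sumFin (λ i → sumFin (λ j → v x a * (u i x * M (i , j) * τ (u j y)) * τ (v y b)))
          ≡⟨ sumFin-cong {m} (λ i → sumFin-cong {m} (λ j → solve 5 (λ va ui mm tu tv → va :* (ui :* mm :* tu) :* tv := ui :* va :* mm :* (tu :* tv)) refl (v x a) (u i x) (M (i , j)) (τ (u j y)) (τ (v y b)))) ⟩
        sumFin (λ i → sumFin (λ j → T x y i j)) ∎
      collect : ∀ i j → sumFin (λ x → u i x * v x a) * M (i , j) * τ (sumFin (λ y → u j y * v y b)) ≡ sumFin (λ x → sumFin (λ y → T x y i j))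
      collect i j = begin
        sumFin (λ x → u i x * v x a) * M (i , j) * τ (sumFin (λ y → u j y * v y b))
          ≡⟨ cong (sumFin (λ x → u i x * v x a) * M (i , j) *_) (trans (τ-sumFin {m′} _) (sumFin-cong {m′} (λ y → τ-* (u j y) (v y b)))) ⟩
        sumFin (λ x → u i x * v x a) * M (i , j) * sumFin (λ y → τ (u j y) * τ (v y b))
          ≡⟨ trans (cong (_* _) (*-distribʳ-sumFin {m′} (M (i , j)) _)) (*-distribʳ-sumFin {m′} _ _) ⟩
        sumFin (λ x → u i x * v x a * M (i , j) * sumFin (λ y → τ (u j y) * τ (v y b)))
          ≡⟨ sumFin-cong {m′} (λ x → *-distribˡ-sumFin {m′} _ _) ⟩
        sumFin (λ x → sumFin (λ y → T x y i j)) ∎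

    assemble : ∀ {w} → K → (Fin w → K) → Square w → Square (suc w)
    assemble x y Z (zero , zero) = x
    assemble x y Z (zero , suc b) = y b
    assemble x y Z (suc a , zero) = twist (y a)
    assemble x y Z (suc a , suc b) = Z (a , b)

    lower-right : ∀ {w} → Square (suc w) → Square w
    lower-right Z (a , b) = Z (suc a , suc b)

    assemble-cong : ∀ {w x x′} {y y′ : Fin w → K} {Z Z′ : Square w} → x ≡ x′ → (∀ b → y b ≡ y′ b) → (∀ p → Z p ≡ Z′ p) →
                    ∀ p → assemble x y Z p ≡ assemble x′ y′ Z′ p
    assemble-cong x≡ y≡ Z≡ (zero , zero) = x≡
    assemble-cong x≡ y≡ Z≡ (zero , suc b) = y≡ b
    assemble-cong x≡ y≡ Z≡ (suc a , zero) = cong twist (y≡ a)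
    assemble-cong x≡ y≡ Z≡ (suc a , suc b) = Z≡ (a , b)

    assemble-hermitian : ∀ {w x} {y : Fin w → K} {Z : Square w} → x ≡ twist x → Diagonal x → IsHermitian Z →
                         IsHermitian (assemble x y Z)
    assemble-hermitian {y = y} x-twisted x-diagonal (Z-twisted , Z-diagonal) = twisted , diagonal
      where
      twisted : IsTwisted (assemble _ y _)
      twisted zero zero = x-twisted
      twisted zero (suc b) = refl
      twisted (suc a) zero = sym (twist-involutive (y a))
      twisted (suc a) (suc b) = Z-twisted a b
      diagonal : ∀ i → Diagonal (assemble _ y _ (i , i))
      diagonal zero = x-diagonal
      diagonal (suc a) = Z-diagonal a

    assemble-split : ∀ {w} {Z : Square (suc w)} → IsTwisted Z → ∀ p → Z p ≡ assemble (Z (zero , zero)) (λ b → Z (zero , suc b)) (lower-right Z) p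
    assemble-split Z-twisted (zero , zero) = refl
    assemble-split Z-twisted (zero , suc b) = refl
    assemble-split Z-twisted (suc a , zero) = Z-twisted zero (suc a)
    assemble-split Z-twisted (suc a , suc b) = refl

    lin-assemble : ∀ {w d} (c : Fin d → K) (x : Fin d → K) (y : Fin d → Fin w → K) (Z : Fin d → Square w) → (∀ t → Scalar (c t)) →
                   ∀ p → lin c (λ t → assemble (x t) (y t) (Z t)) p ≡ assemble (sumFin (λ t → c t * x t)) (lin c y) (lin c Z) p
    lin-assemble c x y Z c∈ (zero , zero) = refl
    lin-assemble c x y Z c∈ (zero , suc b) = refl
    lin-assemble c x y Z c∈ (suc a , zero) = sym (twist-lin c (λ t → y t a) c∈)
    lin-assemble c x y Z c∈ (suc a , suc b) = refl

    module Diag = Coordinates diagonal-coordinates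
    module Entry = Coordinates entry-coordinates

    hermitianDim : ℕ → ℕ
    hermitianDim zero = 0
    hermitianDim (suc w) = Diag.size ℕ.+ (w ℕ.* Entry.size ℕ.+ hermitianDim w)

    record MatrixCoordinates (w : ℕ) : Set where
      field
        basis : Fin (hermitianDim w) → Square w
        basis-hermitian : ∀ t → IsHermitian (basis t)
        coord : Square w → Fin (hermitianDim w) → K
        coord-cong : ∀ {Z Z′} → (∀ p → Z p ≡ Z′ p) → ∀ t → coord Z t ≡ coord Z′ t
        coord∈ : ∀ {Z} → IsHermitian Z → ∀ t → Scalar (coord Z t)
        expand : ∀ {Z} → IsHermitian Z → ∀ p → Z p ≡ lin (coord Z) basis p
        coord-expand : ∀ (c : Fin (hermitianDim w) → K) → (∀ t → Scalar (c t)) → ∀ t → coord (lin c basis) t ≡ c t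

    MatrixCoordinates⇒HasDim : ∀ {w} → MatrixCoordinates w → HasDim (IsHermitian {w}) Scalar (hermitianDim w)
    MatrixCoordinates⇒HasDim {w} C = basis , basis-hermitian , independent , λ Z Z-hermitian → coord Z , coord∈ Z-hermitian , expand Z-hermitian
      where
      open MatrixCoordinates C
      independent : ∀ (c : Fin (hermitianDim w) → K) → (∀ t → Scalar (c t)) → (∀ p → lin c basis p ≡ 0#) → ∀ t → c t ≡ 0#
      independent c c∈ lin≡0 t = begin
        c t                               ≡⟨ sym (coord-expand c c∈ t) ⟩
        coord (lin c basis) t             ≡⟨ coord-cong (λ p → trans (lin≡0 p) (sym (sumFin-zero (λ t → zeroˡ (basis t p))))) t ⟩
        coord (lin (λ _ → 0#) basis) t    ≡⟨ coord-expand (λ _ → 0#) (λ _ → 0∈) t ⟩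
        0#                                ∎

    module Extend {w} (C : MatrixCoordinates w) where
      open MatrixCoordinates C
      N = w ℕ.* Entry.size ℕ.+ hermitianDim w

      row-index : Fin (w ℕ.* Entry.size) → Fin w × Fin Entry.size
      row-index = Fin.remQuot Entry.size

      0ₛ : Fin N → K
      0ₛ _ = 0#

      0ᵥ : ∀ {m} {A : Set} → Fin m → A → K
      0ᵥ _ _ = 0#

      corner-part : Fin (Diag.size ℕ.+ N) → K
      corner-part = Diag.vector ++ 0ₛ

      row-basis : Fin (w ℕ.* Entry.size) → Fin w → K
      row-basis u b = δ (proj₁ (row-index u)) b * Entry.vector (proj₂ (row-index u))

      row-part : Fin (Diag.size ℕ.+ N) → Fin w → K
      row-part = 0ᵥ {Diag.size} ++ (row-basis ++ 0ᵥ {hermitianDim w})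

      block-part : Fin (Diag.size ℕ.+ N) → Square w
      block-part = 0ᵥ {Diag.size} ++ (0ᵥ {w ℕ.* Entry.size} ++ basis)

      basis′ : Fin (Diag.size ℕ.+ N) → Square (suc w)
      basis′ t = assemble (corner-part t) (row-part t) (block-part t)

      row-coord : Square (suc w) → Fin (w ℕ.* Entry.size) → K
      row-coord Z u = Entry.coord (Z (zero , suc (proj₁ (row-index u)))) (proj₂ (row-index u))

      coord′ : Square (suc w) → Fin (Diag.size ℕ.+ N) → K
      coord′ Z = Diag.coord (Z (zero , zero)) ++ (row-coord Z ++ coord (lower-right Z))

      module _ (c : Fin (Diag.size ℕ.+ N) → K) where
        c-corner : Fin Diag.size → K
        c-corner i = c (i ↑ˡ N)
        c-row : Fin w → Fin Entry.size → K
        c-row j s = c (Diag.size ↑ʳ (Fin.combine j s ↑ˡ hermitianDim w))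
        c-block : Fin (hermitianDim w) → K
        c-block v = c (Diag.size ↑ʳ (w ℕ.* Entry.size ↑ʳ v))

        corner-sum : sumFin (λ t → c t * corner-part t) ≡ sumFin (λ i → c-corner i * Diag.vector i)
        corner-sum = sumFin-++-zeroʳ Diag.size N Diag.vector 0ₛ (λ t x → c t * x) (λ _ → zeroʳ _)

        row-sum : ∀ b → lin c row-part b ≡ sumFin (λ s → c-row b s * Entry.vector s)
        row-sum b = begin
          lin c row-part b
            ≡⟨ sumFin-++-zeroˡ Diag.size N 0ᵥ (row-basis ++ 0ᵥ {hermitianDim w}) (λ t y → c t * y b) (λ _ → zeroʳ _) ⟩
          sumFin (λ t → c (Diag.size ↑ʳ t) * (row-basis ++ 0ᵥ {hermitianDim w}) t b)
            ≡⟨ sumFin-++-zeroʳ (w ℕ.* Entry.size) (hermitianDim w) row-basis 0ᵥ (λ t y → c (Diag.size ↑ʳ t) * y b) (λ _ → zeroʳ _) ⟩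
          sumFin (λ u → c (Diag.size ↑ʳ (u ↑ˡ hermitianDim w)) * row-basis u b)
            ≡⟨ sumFin-combine w Entry.size _ ⟩
          sumFin (λ j → sumFin (λ s → c-row j s * row-basis (Fin.combine j s) b))
            ≡⟨ sumFin-cong (λ j → sumFin-cong (λ s → cong (λ (js : Fin w × Fin Entry.size) → c-row j s * (δ (proj₁ js) b * Entry.vector (proj₂ js))) (Fin.remQuot-combine j s))) ⟩
          sumFin (λ j → sumFin (λ s → c-row j s * (δ j b * Entry.vector s)))
            ≡⟨ sumFin-cong (λ j → trans (sumFin-cong (λ s → solve 3 (λ c d v → c :* (d :* v) := d :* (c :* v)) refl (c-row j s) (δ j b) (Entry.vector s))) (sym (*-distribˡ-sumFin {Entry.size} (δ j b) _))) ⟩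
          sumFin (λ j → δ j b * sumFin (λ s → c-row j s * Entry.vector s))
            ≡⟨ trans (sumFin-cong (λ j → cong (_* _) (δ-sym j b))) (sumFin-δ b (λ j → sumFin (λ s → c-row j s * Entry.vector s))) ⟩
          sumFin (λ s → c-row b s * Entry.vector s) ∎

        block-sum : ∀ p → lin c block-part p ≡ lin c-block basis p
        block-sum p = trans (sumFin-++-zeroˡ Diag.size N 0ᵥ (0ᵥ {w ℕ.* Entry.size} ++ basis) (λ t Z → c t * Z p) (λ _ → zeroʳ _))
                            (sumFin-++-zeroˡ (w ℕ.* Entry.size) (hermitianDim w) 0ᵥ basis (λ t Z → c (Diag.size ↑ʳ t) * Z p) (λ _ → zeroʳ _))

        lin-basis′ : (∀ t → Scalar (c t)) → ∀ p →
          lin c basis′ p ≡ assemble (sumFin (λ i → c-corner i * Diag.vector i)) (λ b → sumFin (λ s → c-row b s * Entry.vector s)) (lin c-block basis) p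
        lin-basis′ c∈ p = trans (lin-assemble c corner-part row-part block-part c∈ p) (assemble-cong corner-sum row-sum block-sum p)

      basis′-hermitian : ∀ t → IsHermitian (basis′ t)
      basis′-hermitian t = assemble-hermitian
        (++-∀ {P = λ x → x ≡ twist x} Diag.vector 0ₛ (λ i → proj₁ (Diag.vector∈ i)) (λ _ → sym twist-0) t)
        (++-∀ {P = Diagonal} Diag.vector 0ₛ (λ i → proj₂ (Diag.vector∈ i)) (λ _ → Diagonal-0) t)
        (++-∀ {P = IsHermitian} (0ᵥ {Diag.size}) (0ᵥ {w ℕ.* Entry.size} ++ basis) (λ _ → 0ᵥ-hermitian)
          (++-∀ {P = IsHermitian} (0ᵥ {w ℕ.* Entry.size}) basis (λ _ → 0ᵥ-hermitian) basis-hermitian) t)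
        where
        0ᵥ-hermitian : IsHermitian {w} (λ _ → 0#)
        0ᵥ-hermitian = (λ _ _ → sym twist-0) , (λ _ → Diagonal-0)

      coord′-cong : ∀ {Z Z′} → (∀ p → Z p ≡ Z′ p) → ∀ t → coord′ Z t ≡ coord′ Z′ t
      coord′-cong Z≡ = ++-cong _ _ (λ i → cong (λ z → Diag.coord z i) (Z≡ (zero , zero)))
        (++-cong _ _ (λ u → cong (λ z → Entry.coord z (proj₂ (row-index u))) (Z≡ (zero , suc (proj₁ (row-index u)))))
                     (coord-cong (λ (a , b) → Z≡ (suc a , suc b))))

      lower-right-hermitian : ∀ {Z : Square (suc w)} → IsHermitian Z → IsHermitian (lower-right Z)
      lower-right-hermitian (Z-twisted , Z-diagonal) = (λ a b → Z-twisted (suc a) (suc b)) , (λ a → Z-diagonal (suc a))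

      coord′∈ : ∀ {Z} → IsHermitian Z → ∀ t → Scalar (coord′ Z t)
      coord′∈ {Z} Z-hermitian@(Z-twisted , Z-diagonal) = ++-∀ {P = Scalar} _ _
        (Diag.coord∈ _ (Z-twisted zero zero , Z-diagonal zero))
        (++-∀ {P = Scalar} _ _ (λ u → Entry.coord∈ _ tt _) (coord∈ (lower-right-hermitian Z-hermitian)))

      expand′ : ∀ {Z} → IsHermitian Z → ∀ p → Z p ≡ lin (coord′ Z) basis′ p
      expand′ {Z} Z-hermitian@(Z-twisted , _) p = begin
        Z p
          ≡⟨ assemble-split Z-twisted p ⟩
        assemble (Z (zero , zero)) (λ b → Z (zero , suc b)) (lower-right Z) p
          ≡⟨ assemble-cong (Diag.expand _ (Z-twisted zero zero , proj₂ Z-hermitian zero)) (λ b → Entry.expand _ tt)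
                           (expand (lower-right-hermitian Z-hermitian)) p ⟩
        assemble (sumFin (λ i → Diag.coord (Z (zero , zero)) i * Diag.vector i))
                 (λ b → sumFin (λ s → Entry.coord (Z (zero , suc b)) s * Entry.vector s))
                 (lin (coord (lower-right Z)) basis) p
          ≡⟨ assemble-cong (sumFin-cong (λ i → cong (_* Diag.vector i) (sym (lookup-++ˡ _ _ i))))
                           (λ b → sumFin-cong (λ s → cong (_* Entry.vector s) (sym (row-lookup b s))))
                           (λ p → sumFin-cong (λ v → cong (_* basis v p) (sym (block-lookup v)))) p ⟩
        assemble (sumFin (λ i → c-corner (coord′ Z) i * Diag.vector i))
                 (λ b → sumFin (λ s → c-row (coord′ Z) b s * Entry.vector s))
                 (lin (c-block (coord′ Z)) basis) p
          ≡⟨ sym (lin-basis′ (coord′ Z) (coord′∈ Z-hermitian) p) ⟩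
        lin (coord′ Z) basis′ p ∎
        where
        row-lookup : ∀ b s → c-row (coord′ Z) b s ≡ Entry.coord (Z (zero , suc b)) s
        row-lookup b s = trans (lookup-++ʳ (Diag.coord (Z (zero , zero))) _ _)
          (trans (lookup-++ˡ (row-coord Z) _ _)
            (cong (λ (js : Fin w × Fin Entry.size) → Entry.coord (Z (zero , suc (proj₁ js))) (proj₂ js)) (Fin.remQuot-combine b s)))
        block-lookup : ∀ v → c-block (coord′ Z) v ≡ coord (lower-right Z) v
        block-lookup v = trans (lookup-++ʳ (Diag.coord (Z (zero , zero))) _ _) (lookup-++ʳ (row-coord Z) _ v)

      coord′-expand : ∀ (c : Fin (Diag.size ℕ.+ N) → K) → (∀ t → Scalar (c t)) → ∀ t → coord′ (lin c basis′) t ≡ c t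
      coord′-expand c c∈ = ∀-↑ Diag.size N corner (∀-↑ (w ℕ.* Entry.size) (hermitianDim w) row block)
        where
        L = lin c basis′
        corner : ∀ i → coord′ L (i ↑ˡ N) ≡ c (i ↑ˡ N)
        corner i = begin
          coord′ L (i ↑ˡ N)                                             ≡⟨ lookup-++ˡ _ _ i ⟩
          Diag.coord (L (zero , zero)) i                                ≡⟨ cong (λ z → Diag.coord z i) (lin-basis′ c c∈ (zero , zero)) ⟩
          Diag.coord (sumFin (λ i → c-corner c i * Diag.vector i)) i    ≡⟨ Diag.coord-expand (c-corner c) (λ _ → c∈ _) i ⟩
          c (i ↑ˡ N)                                                    ∎
        row : ∀ u → coord′ L (Diag.size ↑ʳ (u ↑ˡ hermitianDim w)) ≡ c (Diag.size ↑ʳ (u ↑ˡ hermitianDim w))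
        row u = begin
          coord′ L (Diag.size ↑ʳ (u ↑ˡ hermitianDim w))
            ≡⟨ trans (lookup-++ʳ (Diag.coord (L (zero , zero))) _ _) (lookup-++ˡ (row-coord L) _ u) ⟩
          Entry.coord (L (zero , suc j)) s
            ≡⟨ cong (λ z → Entry.coord z s) (lin-basis′ c c∈ (zero , suc j)) ⟩
          Entry.coord (sumFin (λ s → c-row c j s * Entry.vector s)) s
            ≡⟨ Entry.coord-expand (c-row c j) (λ _ → c∈ _) s ⟩
          c (Diag.size ↑ʳ (Fin.combine j s ↑ˡ hermitianDim w))
            ≡⟨ cong (λ u → c (Diag.size ↑ʳ (u ↑ˡ hermitianDim w))) (Fin.combine-remQuot {w} Entry.size u) ⟩
          c (Diag.size ↑ʳ (u ↑ˡ hermitianDim w)) ∎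
          where
          j = proj₁ (row-index u)
          s = proj₂ (row-index u)
        block : ∀ v → coord′ L (Diag.size ↑ʳ (w ℕ.* Entry.size ↑ʳ v)) ≡ c (Diag.size ↑ʳ (w ℕ.* Entry.size ↑ʳ v))
        block v = begin
          coord′ L (Diag.size ↑ʳ (w ℕ.* Entry.size ↑ʳ v))    ≡⟨ trans (lookup-++ʳ (Diag.coord (L (zero , zero))) _ _) (lookup-++ʳ (row-coord L) _ v) ⟩
          coord (lower-right L) v                            ≡⟨ coord-cong (λ (a , b) → lin-basis′ c c∈ (suc a , suc b)) v ⟩
          coord (lin (c-block c) basis) v                    ≡⟨ coord-expand (c-block c) (λ _ → c∈ _) v ⟩
          c (Diag.size ↑ʳ (w ℕ.* Entry.size ↑ʳ v))           ∎

      coordinates : MatrixCoordinates (suc w)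
      coordinates = record
        { basis = basis′ ; basis-hermitian = basis′-hermitian ; coord = coord′ ; coord-cong = coord′-cong
        ; coord∈ = coord′∈ ; expand = expand′ ; coord-expand = coord′-expand }

    hermitian-coordinates : ∀ w → MatrixCoordinates w
    hermitian-coordinates zero = record
      { basis = λ () ; basis-hermitian = λ () ; coord = λ _ () ; coord-cong = λ _ ()
      ; coord∈ = λ _ () ; expand = λ { _ (() , _) } ; coord-expand = λ _ _ () }
    hermitian-coordinates (suc w) = Extend.coordinates (hermitian-coordinates w)

    dim-hermitian : ∀ w → HasDim (IsHermitian {w}) Scalar (hermitianDim w)
    dim-hermitian w = MatrixCoordinates⇒HasDim (hermitian-coordinates w)

    congruence-map : ∀ {m m′} → (Fin m → Fin m′ → K) → LinearMap (Fin m × Fin m) (Fin m′ × Fin m′)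
    congruence-map u = record
      { apply = congruence u ; apply-cong = congruence-cong (λ _ _ → refl) ; apply-lin = congruence-lin u }

    module ColumnSpace {n} (W : Dim.E n → Set) (W-subspace : Dim.IsSubspace n W) {w} (W-dim : HasDim W AllScalars w) where
      open Dim n using (E; colsp≤; IsSubspace; dot)
      open Orthogonality F q n using (Independent; dual; dot-lin)
      module Wₛ = IsSubspace W-subspace

      b : Fin w → E
      b = proj₁ W-dim

      b-independent : Independent b
      b-independent c = proj₁ (proj₂ (proj₂ W-dim)) c (λ _ → tt)

      e : Fin w → E
      e = proj₁ (dual b b-independent)

      e-dual : ∀ i j → dot (b i) (e j) ≡ δ i j
      e-dual = proj₂ (dual b b-independent)

      W-lin : ∀ {m} (c : Fin m → K) (v : Fin m → E) → (∀ i → W (v i)) → W (lin c v)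
      W-lin {zero} c v v∈W = Wₛ.zero∈
      W-lin {suc m} c v v∈W = Wₛ.+∈ _ _ (Wₛ.*∈ (c zero) (v zero) (v∈W zero)) (W-lin (λ i → c (suc i)) (λ i → v (suc i)) (λ i → v∈W (suc i)))

      W-coordinates : ∀ x → W x → ∀ l → x l ≡ sumFin (λ i → dot x (e i) * b i l)
      W-coordinates x x∈W l with proj₂ (proj₂ (proj₂ W-dim)) x x∈W
      ... | c , _ , x≡ = trans (x≡ l) (sumFin-cong (λ i → cong (_* b i l) (sym coefficient)))
        where
        coefficient : ∀ {i} → dot x (e i) ≡ c i
        coefficient {i} = begin
          dot x (e i)                              ≡⟨ sumFin-cong (λ l → cong (_* e i l) (x≡ l)) ⟩
          dot (lin c b) (e i)                      ≡⟨ dot-lin c b (e i) ⟩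
          sumFin (λ k → c k * dot (b k) (e i))     ≡⟨ sumFin-cong (λ k → cong (c k *_) (e-dual k i)) ⟩
          sumFin (λ k → c k * δ k i)               ≡⟨ sumFin-δʳ i c ⟩
          c i                                      ∎

      Φ : LinearMap (Fin w × Fin w) (Fin n × Fin n)
      Φ = congruence-map b

      Ψ : LinearMap (Fin n × Fin n) (Fin w × Fin w)
      Ψ = congruence-map (λ r i → e i r)

      Ψ∘Φ : ∀ Z p → congruence (λ r i → e i r) (congruence b Z) p ≡ Z p
      Ψ∘Φ Z p = begin
        congruence (λ r i → e i r) (congruence b Z) p           ≡⟨ congruence-∘ b (λ r i → e i r) Z p ⟩
        congruence (λ i a → sumFin (λ x → b i x * e a x)) Z p   ≡⟨ congruence-cong e-dual (λ _ → refl) p ⟩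
        congruence δ Z p                                        ≡⟨ congruence-δ Z p ⟩
        Z p                                                     ∎

      projection : Fin n → Fin n → K
      projection r a = sumFin (λ i → e i r * b i a)

      projection-column : ∀ (A : Square n) → colsp≤ A W → ∀ a s → sumFin (λ r → projection r a * A (r , s)) ≡ A (a , s)
      projection-column A A⊆W a s = begin
        sumFin (λ r → projection r a * A (r , s))
          ≡⟨ sumFin-cong (λ r → trans (*-distribʳ-sumFin {w} (A (r , s)) _) (sumFin-cong (λ i → solve 3 (λ x y z → x :* y :* z := z :* x :* y) refl (e i r) (b i a) (A (r , s))))) ⟩
        sumFin (λ r → sumFin (λ i → A (r , s) * e i r * b i a))
          ≡⟨ sumFin-swap {n} {w} _ ⟩
        sumFin (λ i → sumFin (λ r → A (r , s) * e i r * b i a))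
          ≡⟨ sumFin-cong (λ i → sym (*-distribʳ-sumFin {n} (b i a) _)) ⟩
        sumFin (λ i → dot (λ r → A (r , s)) (e i) * b i a)
          ≡⟨ sym (W-coordinates _ (A⊆W s) a) ⟩
        A (a , s) ∎

      Φ∘Ψ : ∀ (A : Square n) → IsHermitian A × colsp≤ A W → ∀ p → congruence b (congruence (λ r i → e i r) A) p ≡ A p
      Φ∘Ψ A ((A-twisted , _) , A⊆W) (a , c) = begin
        congruence b (congruence (λ r i → e i r) A) (a , c)
          ≡⟨ congruence-∘ (λ r i → e i r) b A (a , c) ⟩
        congruence projection A (a , c)
          ≡⟨ sumFin-swap {n} {n} _ ⟩
        sumFin (λ s → sumFin (λ r → projection r a * A (r , s) * τ (projection s c)))
          ≡⟨ sumFin-cong (λ s → trans (sym (*-distribʳ-sumFin {n} (τ (projection s c)) _)) (cong (_* τ (projection s c)) (projection-column A A⊆W a s))) ⟩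
        sumFin (λ s → A (a , s) * τ (projection s c))
          ≡⟨ sumFin-cong (λ s → cong (_* τ (projection s c)) (A-twisted s a)) ⟩
        sumFin (λ s → ε * τ (A (s , a)) * τ (projection s c))
          ≡⟨ sumFin-cong (λ s → trans (*-assoc ε (τ (A (s , a))) (τ (projection s c))) (cong (ε *_) (trans (sym (τ-* (A (s , a)) (projection s c))) (cong τ (*-comm (A (s , a)) (projection s c)))))) ⟩
        sumFin (λ s → ε * τ (projection s c * A (s , a)))
          ≡⟨ sym (*-distribˡ-sumFin {n} ε _) ⟩
        ε * sumFin (λ s → τ (projection s c * A (s , a)))
          ≡⟨ cong (ε *_) (sym (τ-sumFin {n} _)) ⟩
        ε * τ (sumFin (λ s → projection s c * A (s , a)))
          ≡⟨ cong twist (projection-column A A⊆W c a) ⟩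
        ε * τ (A (c , a))
          ≡⟨ sym (A-twisted c a) ⟩
        A (a , c) ∎

      Φ⊆W : ∀ Z → colsp≤ (congruence b Z) W
      Φ⊆W Z s = Wₛ.resp _ _ (λ r → sumFin-cong (λ i → trans (*-distribʳ-sumFin {w} (b i r) _)
                  (sumFin-cong (λ j → solve 3 (λ x y z → y :* z :* x := x :* y :* z) refl (b i r) (Z (i , j)) (τ (b j s))))))
                  (W-lin (λ i → sumFin (λ j → Z (i , j) * τ (b j s))) b (proj₁ (proj₂ W-dim)))

      dim-hermitian-colsp≤ : HasDim (λ A → IsHermitian A × colsp≤ A W) Scalar (hermitianDim w)
      dim-hermitian-colsp≤ = HasDim-transport {S = Scalar} Φ Ψ
        (λ Z Z-hermitian → congruence-hermitian b Z-hermitian , Φ⊆W Z)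
        (λ A (A-hermitian , _) → congruence-hermitian (λ r i → e i r) A-hermitian)
        Ψ∘Φ Φ∘Ψ (dim-hermitian w)

module MatrixKinds (F : FiniteField) (q : ℕ) where
  open FieldProperties F
  open Over F q
  open Sums F q
  open FiniteFieldFacts F q using (x^order≡x)
  open LinearAlgebra F q
  open HermitianMatrices F q
  open ≡-Reasoning

  single-coordinate : ∀ {S T : K → Set} → T 1# → (∀ x → T x → S x) → Coordinates S T
  single-coordinate T1 T⊆S = record
    { size = 1 ; vector = λ _ → 1# ; vector∈ = λ _ → T1 ; coord = λ x _ → x ; coord∈ = λ x x∈T _ → T⊆S x x∈T
    ; expand = λ x _ → sym (trans (+-identityʳ _) (*-identityʳ x))
    ; coord-expand = λ { c _ zero → trans (+-identityʳ _) (*-identityʳ _) } }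

  -1*x≡-x : ∀ x → - 1# * x ≡ - x
  -1*x≡-x x = trans (sym (-‿distribˡ-* 1# x)) (cong -_ (*-identityˡ x))

  -1*-1≡1 : - 1# * - 1# ≡ 1#
  -1*-1≡1 = trans (solve 1 (λ o → (:- o) :* (:- o) := o :* o) refl 1#) (*-identityˡ 1#)

  module PrimeField (order≡q : order ≡ q ℕ.^ 1) where
    everything-in-Fq : ∀ x → SubfieldFq x
    everything-in-Fq x = trans (cong (x ^_) (sym (trans order≡q (ℕ.*-identityʳ q)))) (x^order≡x x)

    Fq-subfield : IsSubfield SubfieldFq
    Fq-subfield = record
      { 0∈ = everything-in-Fq _ ; 1∈ = everything-in-Fq _ ; +∈ = λ _ _ → everything-in-Fq _ ; -∈ = λ _ → everything-in-Fq _
      ; *∈ = λ _ _ → everything-in-Fq _ ; ⁻¹∈ = λ _ _ → everything-in-Fq _ }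

    alternating : HermitianData SubfieldFq
    alternating = record
      { scalar-subfield = Fq-subfield
      ; τ = λ x → x ; τ-+ = λ _ _ → refl ; τ-* = λ _ _ → refl ; τ-1 = refl ; τ-involutive = λ _ → refl ; τ-scalar = λ _ → refl
      ; ε = - 1# ; ε*ε≡1 = -1*-1≡1 ; τε≡ε = refl
      ; Diagonal = _≡ 0# ; Diagonal-0 = refl
      ; Diagonal-quadratic = λ x Z Z-twisted Z-diagonal → alternating-sumFin (λ i j → x i * Z (i , j) * x j)
          (λ i → trans (cong (λ z → x i * z * x i) (Z-diagonal i)) (trans (cong (_* x i) (zeroʳ (x i))) (zeroˡ (x i))))
          (λ i j → trans (cong (λ z → x j * z * x i) (trans (Z-twisted i j) (-1*x≡-x _)))
                         (solve 3 (λ a z b → b :* (:- z) :* a := :- (a :* z :* b)) refl (x i) (Z (i , j)) (x j)))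
      ; entry-coordinates = single-coordinate tt (λ x _ → everything-in-Fq x)
      ; diagonal-coordinates = record
          { size = 0 ; vector = λ () ; vector∈ = λ () ; coord = λ _ () ; coord∈ = λ _ _ () ; expand = λ _ x∈ → proj₂ x∈
          ; coord-expand = λ _ _ () } }

    symmetric : HermitianData SubfieldFq
    symmetric = record
      { scalar-subfield = Fq-subfield
      ; τ = λ x → x ; τ-+ = λ _ _ → refl ; τ-* = λ _ _ → refl ; τ-1 = refl ; τ-involutive = λ _ → refl ; τ-scalar = λ _ → refl
      ; ε = 1# ; ε*ε≡1 = *-identityˡ 1# ; τε≡ε = refl
      ; Diagonal = λ _ → ⊤ ; Diagonal-0 = tt ; Diagonal-quadratic = λ _ _ _ _ → tt
      ; entry-coordinates = single-coordinate tt (λ x _ → everything-in-Fq x)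
      ; diagonal-coordinates = single-coordinate (sym (*-identityˡ 1#) , tt) (λ x _ → everything-in-Fq x) }

  module QuadraticExtension (q-prime-power : IsPrimePower q) (order≡q² : order ≡ q ℕ.^ 2) where
    open Conjugation F q q-prime-power order≡q²

    σ-x-y : ∀ x y → σ (x - y) ≡ σ x - σ y
    σ-x-y x y = trans (σ-+ x (- y)) (cong (σ x +_) (σ-neg y))

    Fq-subfield : IsSubfield SubfieldFq
    Fq-subfield = record
      { 0∈ = σ-0 ; 1∈ = σ-1
      ; +∈ = λ {x} {y} σx≡x σy≡y → trans (σ-+ x y) (cong₂ _+_ σx≡x σy≡y)
      ; -∈ = λ {x} σx≡x → trans (σ-neg x) (cong -_ σx≡x)
      ; *∈ = λ {x} {y} σx≡x σy≡y → trans (σ-* x y) (cong₂ _*_ σx≡x σy≡y)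
      ; ⁻¹∈ = λ {x} σx≡x x≢0 → *-cancelˡ x x≢0 (begin
          x * σ (x ⁻¹⟨ x≢0 ⟩)      ≡⟨ cong (_* σ (x ⁻¹⟨ x≢0 ⟩)) (sym σx≡x) ⟩
          σ x * σ (x ⁻¹⟨ x≢0 ⟩)    ≡⟨ sym (σ-* x _) ⟩
          σ (x * x ⁻¹⟨ x≢0 ⟩)      ≡⟨ cong σ (*-inverseʳ x x≢0) ⟩
          σ 1#                     ≡⟨ σ-1 ⟩
          1#                       ≡⟨ sym (*-inverseʳ x x≢0) ⟩
          x * x ⁻¹⟨ x≢0 ⟩          ∎) }

    ω : K
    ω = proj₁ σ-nontrivial

    Δ : K
    Δ = ω - σ ω

    Δ≢0 : ¬ Δ ≡ 0#
    Δ≢0 Δ≡0 = proj₂ σ-nontrivial (sym (x-y≡0⇒x≡y Δ≡0))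

    Δ⁻¹ : K
    Δ⁻¹ = Δ ⁻¹⟨ Δ≢0 ⟩

    σ-anti : ∀ x → σ (x - σ x) ≡ - (x - σ x)
    σ-anti x = trans (σ-x-y x (σ x)) (trans (cong (λ z → σ x - z) (σ-involutive x))
                 (solve 2 (λ a b → a :- b := :- (b :- a)) refl (σ x) x))

    σΔ⁻¹ : σ Δ⁻¹ ≡ - Δ⁻¹
    σΔ⁻¹ = *-cancelˡ Δ Δ≢0 (begin
      Δ * σ Δ⁻¹              ≡⟨ solve 2 (λ d s → d :* s := :- ((:- d) :* s)) refl Δ (σ Δ⁻¹) ⟩
      - ((- Δ) * σ Δ⁻¹)      ≡⟨ cong (λ z → - (z * σ Δ⁻¹)) (sym (σ-anti ω)) ⟩
      - (σ Δ * σ Δ⁻¹)        ≡⟨ cong -_ (sym (σ-* Δ Δ⁻¹)) ⟩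
      - σ (Δ * Δ⁻¹)          ≡⟨ cong (λ z → - σ z) (*-inverseʳ Δ Δ≢0) ⟩
      - σ 1#                 ≡⟨ cong -_ σ-1 ⟩
      - 1#                   ≡⟨ cong -_ (sym (*-inverseʳ Δ Δ≢0)) ⟩
      - (Δ * Δ⁻¹)            ≡⟨ solve 2 (λ d i → :- (d :* i) := d :* (:- i)) refl Δ Δ⁻¹ ⟩
      Δ * - Δ⁻¹              ∎)

    -- Coordinates in the F_q-basis {1, ω}: x = re x + ω · im x.
    im re : K → K
    im x = (x - σ x) * Δ⁻¹
    re x = x - ω * im x

    im∈Fq : ∀ x → SubfieldFq (im x)
    im∈Fq x = begin
      σ ((x - σ x) * Δ⁻¹)        ≡⟨ σ-* _ Δ⁻¹ ⟩
      σ (x - σ x) * σ Δ⁻¹        ≡⟨ cong₂ _*_ (σ-anti x) σΔ⁻¹ ⟩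
      - (x - σ x) * - Δ⁻¹        ≡⟨ solve 2 (λ y i → (:- y) :* (:- i) := y :* i) refl (x - σ x) Δ⁻¹ ⟩
      (x - σ x) * Δ⁻¹            ∎

    re∈Fq : ∀ x → SubfieldFq (re x)
    re∈Fq x = sym (x-y≡0⇒x≡y (begin
      re x - σ (re x)
        ≡⟨ cong (λ z → re x - z) (trans (σ-x-y x (ω * im x)) (cong (λ z → σ x - z) (trans (σ-* ω (im x)) (cong (σ ω *_) (im∈Fq x))))) ⟩
      (x - ω * im x) - (σ x - σ ω * im x)
        ≡⟨ solve 5 (λ x s w t i → (x :- w :* i) :- (s :- t :* i) := (x :- s) :- (w :- t) :* i) refl x (σ x) ω (σ ω) (im x) ⟩
      (x - σ x) - Δ * im x
        ≡⟨ cong (λ z → (x - σ x) - z) (Δ*im x) ⟩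
      (x - σ x) - (x - σ x)
        ≡⟨ -‿inverseʳ _ ⟩
      0# ∎))
      where
      Δ*im : ∀ x → Δ * im x ≡ x - σ x
      Δ*im x = trans (solve 3 (λ d y i → d :* (y :* i) := y :* (d :* i)) refl Δ (x - σ x) Δ⁻¹)
                     (trans (cong ((x - σ x) *_) (*-inverseʳ Δ Δ≢0)) (*-identityʳ _))

    im-re-expand : ∀ (c : Fin 2 → K) → (∀ t → SubfieldFq (c t)) →
                   let y = c zero * 1# + (c (suc zero) * ω + 0#) in re y ≡ c zero × im y ≡ c (suc zero)
    im-re-expand c c∈ = re-y , im-y
      where
      c₀ = c zero
      c₁ = c (suc zero)
      y = c₀ * 1# + (c₁ * ω + 0#)
      σy : σ y ≡ c₀ * 1# + (c₁ * σ ω + 0#)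
      σy = begin
        σ y                                       ≡⟨ σ-+ _ _ ⟩
        σ (c₀ * 1#) + σ (c₁ * ω + 0#)             ≡⟨ cong₂ _+_ (trans (σ-* c₀ 1#) (cong₂ _*_ (c∈ zero) σ-1))
                                                               (trans (σ-+ _ _) (cong₂ _+_ (trans (σ-* c₁ ω) (cong (_* σ ω) (c∈ (suc zero)))) σ-0)) ⟩
        c₀ * 1# + (c₁ * σ ω + 0#)                 ∎
      im-y : im y ≡ c₁
      im-y = begin
        (y - σ y) * Δ⁻¹
          ≡⟨ cong (λ z → (y - z) * Δ⁻¹) σy ⟩
        (y - (c₀ * 1# + (c₁ * σ ω + 0#))) * Δ⁻¹
                                 ≡⟨ cong (_* Δ⁻¹) (solve 5 (λ c₀ o c₁ w s → (c₀ :* o :+ (c₁ :* w :+ con ℤ.0ℤ)) :- (c₀ :* o :+ (c₁ :* s :+ con ℤ.0ℤ)) := c₁ :* (w :- s)) refl c₀ 1# c₁ ω (σ ω)) ⟩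
        c₁ * Δ * Δ⁻¹
          ≡⟨ *-assoc _ _ _ ⟩
        c₁ * (Δ * Δ⁻¹)
          ≡⟨ cong (c₁ *_) (*-inverseʳ Δ Δ≢0) ⟩
        c₁ * 1#
          ≡⟨ *-identityʳ c₁ ⟩
        c₁ ∎
      re-y : re y ≡ c₀
      re-y = begin
        y - ω * im y             ≡⟨ cong (λ z → y - ω * z) im-y ⟩
        y - ω * c₁               ≡⟨ solve 4 (λ c₀ o c₁ w → (c₀ :* o :+ (c₁ :* w :+ con ℤ.0ℤ)) :- w :* c₁ := c₀ :* o) refl c₀ 1# c₁ ω ⟩
        c₀ * 1#                  ≡⟨ *-identityʳ c₀ ⟩
        c₀                       ∎

    entry-coordinates : Coordinates SubfieldFq (λ _ → ⊤)
    entry-coordinates = record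
      { size = 2 ; vector = vector ; vector∈ = λ _ → tt ; coord = coord ; coord∈ = λ x _ → coord∈ x
      ; expand = λ x _ → sym (expand x) ; coord-expand = λ c c∈ → coord-expand c c∈ }
      where
      vector : Fin 2 → K
      vector zero = 1#
      vector (suc zero) = ω
      coord : K → Fin 2 → K
      coord x zero = re x
      coord x (suc zero) = im x
      coord∈ : ∀ x t → SubfieldFq (coord x t)
      coord∈ x zero = re∈Fq x
      coord∈ x (suc zero) = im∈Fq x
      expand : ∀ x → sumFin (λ t → coord x t * vector t) ≡ x
      expand x = begin
        re x * 1# + (im x * ω + 0#)        ≡⟨ cong (_+ (im x * ω + 0#)) (*-identityʳ _) ⟩
        (x - ω * im x) + (im x * ω + 0#)   ≡⟨ solve 3 (λ x w b → (x :- w :* b) :+ (b :* w :+ con ℤ.0ℤ) := x) refl x ω (im x) ⟩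
        x                                  ∎
      coord-expand : ∀ (c : Fin 2 → K) → (∀ t → SubfieldFq (c t)) → ∀ t → coord (sumFin (λ t′ → c t′ * vector t′)) t ≡ c t
      coord-expand c c∈ zero = proj₁ (im-re-expand c c∈)
      coord-expand c c∈ (suc zero) = proj₂ (im-re-expand c c∈)

    hermitian : HermitianData SubfieldFq
    hermitian = record
      { scalar-subfield = Fq-subfield
      ; τ = σ ; τ-+ = σ-+ ; τ-* = σ-* ; τ-1 = σ-1 ; τ-involutive = σ-involutive ; τ-scalar = λ σc≡c → σc≡c
      ; ε = 1# ; ε*ε≡1 = *-identityˡ 1# ; τε≡ε = σ-1
      ; Diagonal = λ _ → ⊤ ; Diagonal-0 = tt ; Diagonal-quadratic = λ _ _ _ _ → tt
      ; entry-coordinates = entry-coordinates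
      ; diagonal-coordinates = single-coordinate (sym (trans (*-identityˡ _) σ-1) , tt) (λ x x≡σx → sym (trans (proj₁ x≡σx) (*-identityˡ _))) }

  kind-data : (k : Kind) → IsPrimePower q → order ≡ q ℕ.^ ℓ k → HermitianData SubfieldFq
  kind-data alt _ order≡q = PrimeField.alternating order≡q
  kind-data Kind.sym _ order≡q = PrimeField.symmetric order≡q
  kind-data her q-prime-power order≡q² = QuadraticExtension.hermitian q-prime-power order≡q²

  module _ {n : ℕ} where
    open Dim n using (Mat; X)

    X⇒IsHermitian : ∀ k q-pp ord (A : Mat) → X k A → Hermitian.IsHermitian (kind-data k q-pp ord) A
    X⇒IsHermitian alt _ _ A (diagonal≡0 , antisymmetric) = (λ i j → trans (antisymmetric i j) (sym (-1*x≡-x _))) , diagonal≡0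
    X⇒IsHermitian Kind.sym _ _ A symmetric = (λ i j → trans (symmetric i j) (sym (*-identityˡ _))) , λ _ → tt
    X⇒IsHermitian her _ _ A hermitian = (λ i j → trans (hermitian i j) (sym (*-identityˡ _))) , λ _ → tt

    IsHermitian⇒X : ∀ k q-pp ord (A : Mat) → Hermitian.IsHermitian (kind-data k q-pp ord) A → X k A
    IsHermitian⇒X alt _ _ A (twisted , diagonal≡0) = diagonal≡0 , λ i j → trans (twisted i j) (-1*x≡-x _)
    IsHermitian⇒X Kind.sym _ _ A (twisted , _) = λ i j → trans (twisted i j) (*-identityˡ _)
    IsHermitian⇒X her _ _ A (twisted , _) = λ i j → trans (twisted i j) (*-identityˡ _)

  dimX : Kind → ℕ → ℕ
  dimX alt w = w C 2
  dimX Kind.sym w = suc w C 2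
  dimX her w = w ℕ.* w

  hermitianDim≡dimX : ∀ k q-pp ord w → Hermitian.hermitianDim (kind-data k q-pp ord) w ≡ dimX k w
  hermitianDim≡dimX alt _ _ zero = refl
  hermitianDim≡dimX Kind.sym _ _ zero = refl
  hermitianDim≡dimX her _ _ zero = refl
  hermitianDim≡dimX alt q-pp ord (suc w) =
    trans (cong₂ ℕ._+_ (trans (ℕ.*-identityʳ w) (sym (nC1≡n w))) (hermitianDim≡dimX alt q-pp ord w)) (nCk+nC[k+1]≡[n+1]C[k+1] w 1)
  hermitianDim≡dimX Kind.sym q-pp ord (suc w) =
    trans (cong suc (cong₂ ℕ._+_ (ℕ.*-identityʳ w) (hermitianDim≡dimX Kind.sym q-pp ord w)))
          (trans (cong (ℕ._+ (suc w C 2)) (sym (nC1≡n (suc w)))) (nCk+nC[k+1]≡[n+1]C[k+1] (suc w) 1))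
  hermitianDim≡dimX her q-pp ord (suc w) =
    trans (cong (λ z → suc (w ℕ.* 2 ℕ.+ z)) (hermitianDim≡dimX her q-pp ord w))
          (suc[2w+w*w]≡[1+w]*[1+w] w)

  dim-X-colsp≤ : ∀ k q-pp ord {n} {W : Dim.E n → Set} → Dim.IsSubspace n W → ∀ {w} → HasDim W AllScalars w →
                 ∀ {m} → HasDim (λ A → Dim.X n k A × Dim.colsp≤ n A W) SubfieldFq m → m ≡ dimX k w
  dim-X-colsp≤ k q-pp ord {n} W-subspace {w} W-dim {m} X-dim = begin
    m                               ≡⟨ HasDim-unique scalar-subfield
                                         (HasDim-⇔ {P = SubfieldFq} X-dim (λ A (A∈X , A⊆W) → X⇒IsHermitian k q-pp ord A A∈X , A⊆W)
                                                         (λ A (A-hermitian , A⊆W) → IsHermitian⇒X k q-pp ord A A-hermitian , A⊆W))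
                                         (ColumnSpace.dim-hermitian-colsp≤ _ W-subspace W-dim) ⟩
    hermitianDim w                  ≡⟨ hermitianDim≡dimX k q-pp ord w ⟩
    dimX k w                        ∎
    where open Hermitian (kind-data k q-pp ord)

  dimX∸dimX≡formula : ∀ k v d → dimX k v ℕ.∸ dimX k d ≡ formula k v d
  dimX∸dimX≡formula alt v d = refl
  dimX∸dimX≡formula Kind.sym v d = refl
  dimX∸dimX≡formula her v d = v*v∸d*d≡[v∸d]*[v+d] v d

open import Data.Nat using (_≤_; _∸_; _^_)

theorem3p5 : (k : Kind) (q : ℕ) → IsPrimePower q →
  (F : FiniteField) → FiniteField.order F ≡ q ^ ℓ k →
  (n : ℕ) → 1 ≤ n →
  (V U : Over.Dim.E F q n → Set) →
  Over.Dim.IsSubspace F q n V → Over.Dim.IsSubspace F q n U →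
  (v d a b : ℕ) →
  Over.HasDim F q V (Over.AllScalars F q) v →
  Over.HasDim F q (Over.Dim._∩_ F q n V (Over.Dim._⊥ F q n U)) (Over.AllScalars F q) d →
  Over.HasDim F q (Over.Dim.X[_] F q n k V) (Over.SubfieldFq F q) a →
  Over.HasDim F q (Over.Dim._[_,c] F q n (Over.Dim.X[_] F q n k V) (Over.Dim._⊥ F q n U)) (Over.SubfieldFq F q) b →
  a ∸ b ≡ formula k v d
theorem3p5 k q q-prime-power F order≡q^ℓ n _ V U V-subspace U-subspace v d a b V-dim V∩U⊥-dim a-dim b-dim = begin
  a ∸ b                 ≡⟨ cong₂ _∸_ (dim-X-colsp≤ k q-prime-power order≡q^ℓ V-subspace V-dim a-dim)
                                     (dim-X-colsp≤ k q-prime-power order≡q^ℓ V∩U⊥-subspace V∩U⊥-dim b-dim′) ⟩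
  dimX k v ∸ dimX k d   ≡⟨ dimX∸dimX≡formula k v d ⟩
  formula k v d         ∎
  where
  open MatrixKinds F q
  open LinearAlgebra F q using (HasDim-⇔)
  open Orthogonality F q n using (⊥-subspace; ∩-subspace)
  open Over F q using (HasDim; SubfieldFq)
  open Over.Dim F q n using (X; X[_]; _[_,c]; _∩_; _⊥; colsp≤; IsSubspace)
  open ≡-Reasoning

  V∩U⊥-subspace : IsSubspace (V ∩ (U ⊥))
  V∩U⊥-subspace = ∩-subspace V-subspace (⊥-subspace U)

  C[U⊥,c]⊆X[V∩U⊥] : ∀ A → (X[ k ] V [ U ⊥ ,c]) A → X k A × colsp≤ A (V ∩ (U ⊥))
  C[U⊥,c]⊆X[V∩U⊥] A ((A∈X , A⊆V) , A⊆U⊥) = A∈X , λ j → A⊆V j , A⊆U⊥ j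

  X[V∩U⊥]⊆C[U⊥,c] : ∀ A → X k A × colsp≤ A (V ∩ (U ⊥)) → (X[ k ] V [ U ⊥ ,c]) A
  X[V∩U⊥]⊆C[U⊥,c] A (A∈X , A⊆V∩U⊥) = (A∈X , λ j → proj₁ (A⊆V∩U⊥ j)) , λ j → proj₂ (A⊆V∩U⊥ j)

  b-dim′ : HasDim (λ A → X k A × colsp≤ A (V ∩ (U ⊥))) SubfieldFq b
  b-dim′ = HasDim-⇔ {P = SubfieldFq} b-dim C[U⊥,c]⊆X[V∩U⊥] X[V∩U⊥]⊆C[U⊥,c]
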